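{- Let $n>k\geq m\geq 3$ be integers. The number of $k$-element subsets $S$ of the vertex set of the cycle $C_n$ (with labeled vertices) such that the induced subgraph $C_n[S]$ contains a path on $m$ vertices (i.e. at least $m$ of the selected vertices are consecutive on the cycle) equals $$R_m(n,k):=\sum_{t=1}^n(-1)^{t-1}\frac{n}{t}\binom{n-mt-1}{t-1}\binom{n-(m+1)t}{k-mt}.$$
   Context: Convention for binomial coefficients: $\binom{a}{b}=0$ whenever $b<0$ or $a<b$ (in particular when $a$ is negative). -}

module Defs where

open import Data.Nat as ℕ using (ℕ; zero; suc; _≟_)
open import Data.Nat.DivMod using (_mod_)
open import Data.Nat.Combinatorics using (_C_)
open import Data.Integer as ℤ using (ℤ; +_; -[1+_]; _-_; -1ℤ; 1ℤ)
open import Data.Rational as ℚ using (ℚ; _/_)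
open import Data.Bool using (Bool; true; false)
open import Data.Vec using (Vec; []; _∷_)
open import Data.List using (List; []; _∷_; map; _++_; filter; length; upTo; foldr)
open import Data.Fin using (Fin; toℕ)
open import Data.Fin.Subset using (Subset; _∈_; ∣_∣)
open import Data.Fin.Subset.Properties using (_∈?_)
open import Data.Fin.Properties using (any?; all?)
open import Data.Product using (Σ; _×_; Σ-syntax)
open import Relation.Nullary.Decidable using (Dec; _×-dec_)
open import Relation.Binary.PropositionalEquality using (_≡_)

-- Binomial coefficient with integer arguments; 0 if b < 0 or a < b
-- (in particular 0 when a is negative).  For a, b ≥ 0, a C b = 0 when b > a.
binomℤ : ℤ → ℤ → ℕ
binomℤ (+ a) (+ b) = a C b
binomℤ (+ a) -[1+ b ] = 0
binomℤ -[1+ a ] _ = 0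

allSubsets : (n : ℕ) → List (Subset n)
allSubsets zero = [] ∷ []
allSubsets (suc n) = map (true ∷_) (allSubsets n) ++ map (false ∷_) (allSubsets n)

cyc : {n : ℕ} → Fin n → ℕ → Fin n
cyc {suc n} i j = (toℕ i ℕ.+ j) mod suc n

-- C_n[S] contains a path on m vertices: some m cyclically consecutive
-- vertices i, i+1, ..., i+m-1 (mod n) all lie in S.
HasRun : (n m : ℕ) → Subset n → Set
HasRun n m S = Σ[ i ∈ Fin n ] ((j : Fin m) → cyc i (toℕ j) ∈ S)

hasRun? : (n m : ℕ) → (S : Subset n) → Dec (HasRun n m S)
hasRun? n m S = any? (λ i → all? (λ j → cyc i (toℕ j) ∈? S))

IsGood : (n m k : ℕ) → Subset n → Set
IsGood n m k S = (∣ S ∣ ≡ k) × HasRun n m S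

good? : (n m k : ℕ) → (S : Subset n) → Dec (IsGood n m k S)
good? n m k S = (∣ S ∣ ≟ k) ×-dec hasRun? n m S

count : (n m k : ℕ) → ℕ
count n m k = length (filter (good? n m k) (allSubsets n))

Rterm : (n m k : ℕ) → ℕ → ℚ
Rterm n m k i =
  ((-1ℤ ℤ.^ i) ℤ.* + n
     ℤ.* + binomℤ (+ n - + (m ℕ.* t) - 1ℤ) (+ i)
     ℤ.* + binomℤ (+ n - + (suc m ℕ.* t)) (+ k - + (m ℕ.* t))) / t
  where t = suc i

R : (m n k : ℕ) → ℚ
R m n k = foldr ℚ._+_ ℚ.0ℚ (map (Rterm n m k) (upTo n))

module Submission where

-- A proper subset S contains m consecutive vertices iff it has a "run
-- start": a vertex outside S followed by m vertices of S.  Inclusion–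
-- exclusion over the set of run starts writes the count as
-- Σ_{t≥1} (-1)^{t-1} W(t), where W(t) counts the pairs (S, T) with |S| = k,
-- |T| = t and every vertex of T a run start of S.  Rotating the cycle gives
-- t·W(t) = n·V(t), where V(t) additionally requires 0 ∈ T.  Cutting the
-- cycle at 0 turns V(t) into a count of "compatible" pairs on a path; these
-- satisfy a Pascal-type recursion in the length of the path, whose solution
-- is C(n-mt-1, t-1)·C(n-(m+1)t, k-mt).  The integer identity is finally
-- moved to ℚ, where R_m divides by t.

open import Algebra.Bundles using (CommutativeMonoid)
open import Algebra.Core using (Op₂)
open import Algebra.Structures using (IsCommutativeMonoid)
import Algebra.Properties.CommutativeSemigroup as CSProperties
open import Data.Bool using (Bool; true; false; _∧_; _∨_; not; T)
open import Data.Bool.Properties using (∧-comm; ∨-identityʳ)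
open import Data.Empty using (⊥-elim)
open import Data.Fin as Fin using (Fin; toℕ; fromℕ<)
open import Data.Fin.Properties using (toℕ-fromℕ<; toℕ<n)
open import Data.Fin.Subset using (∣_∣; _∈_)
open import Data.Fin.Subset.Properties using (∣p∣≤n)
open import Data.Integer as ℤ using (ℤ; +_; -[1+_]; -1ℤ; 1ℤ; 0ℤ; _-_; _^_)
import Data.Integer.Properties as ℤP
open import Data.Integer.Tactic.RingSolver using (solve-∀)
open import Data.List as List using (List; length; filter)
open import Data.List.Properties using (map-++; map-∘)
open import Data.Nat as ℕ using (ℕ; zero; suc; _+_; _*_; _∸_; _≤_; _<_; z≤n; s≤s; _≡ᵇ_)
open import Data.Nat.Combinatorics using (_C_; nCk+nC[k+1]≡[n+1]C[k+1]; k>n⇒nCk≡0)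
open import Data.Nat.DivMod using (_%_; _mod_; m<n⇒m%n≡m; [m+n]%n≡m%n; m≡m%n+[m/n]*n; [m+kn]%n≡m%n;
  %-distribˡ-+; m%n%n≡m%n; m%n<n; n%n≡0)
open import Data.Nat.ListAction using (sum)
open import Data.Nat.ListAction.Properties using (sum-++)
open import Data.Nat.Properties
open import Data.Product using (Σ; _×_; _,_; proj₁; proj₂)
open import Data.Rational as ℚ using (ℚ; _/_)
import Data.Rational.Properties as ℚP
open import Data.Rational.Unnormalised using (mkℚᵘ; *≡*)
import Data.Rational.Unnormalised.Properties as ℚᵘP
open import Data.Sum using (_⊎_; inj₁; inj₂)
open import Data.Vec using (Vec; []; _∷_; _++_; _∷ʳ_; replicate; lookup; tabulate)
open import Data.Vec.Properties using (lookup⇒[]=; []=⇒lookup)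
open import Relation.Binary.PropositionalEquality
open import Relation.Nullary using (yes; no; Dec; does)
open import Relation.Nullary.Decidable using (dec-true; dec-false)
open import Relation.Unary using (Decidable)
open import Defs using (cyc; HasRun; hasRun?; allSubsets; count; good?; binomℤ; Rterm; R)

module FiniteSums {A : Set} (_∙_ : Op₂ A) (ε : A) where

  Σᵛ : (n : ℕ) → (Vec Bool n → A) → A
  Σᵛ zero    f = f []
  Σᵛ (suc n) f = Σᵛ n (λ x → f (true ∷ x)) ∙ Σᵛ n (λ x → f (false ∷ x))

  Σ< : ℕ → (ℕ → A) → A
  Σ< zero    g = ε
  Σ< (suc r) g = g 0 ∙ Σ< r (λ i → g (suc i))

  Σᵛ-cong : ∀ n {f g : Vec Bool n → A} → (∀ x → f x ≡ g x) → Σᵛ n f ≡ Σᵛ n g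
  Σᵛ-cong zero    e = e []
  Σᵛ-cong (suc n) e = cong₂ _∙_ (Σᵛ-cong n (λ x → e (true ∷ x))) (Σᵛ-cong n (λ x → e (false ∷ x)))

  Σ<-cong : ∀ r {g h : ℕ → A} → (∀ i → i < r → g i ≡ h i) → Σ< r g ≡ Σ< r h
  Σ<-cong zero    e = refl
  Σ<-cong (suc r) e = cong₂ _∙_ (e 0 (s≤s z≤n)) (Σ<-cong r (λ i i<r → e (suc i) (s≤s i<r)))

  Σᵛ-++ : ∀ a b (f : Vec Bool (a + b) → A) → Σᵛ (a + b) f ≡ Σᵛ a (λ y → Σᵛ b (λ z → f (y ++ z)))
  Σᵛ-++ zero    b f = refl
  Σᵛ-++ (suc a) b f = cong₂ _∙_ (Σᵛ-++ a b _) (Σᵛ-++ a b _)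

module _ {A B : Set} {_∙_ : Op₂ A} {ε : A} {_∘_ : Op₂ B} {ε′ : B}
         (h : A → B) (h-∙ : ∀ x y → h (x ∙ y) ≡ h x ∘ h y) where
  private
    module SA = FiniteSums _∙_ ε
    module SB = FiniteSums _∘_ ε′

  Σᵛ-hom : ∀ n (f : Vec Bool n → A) → h (SA.Σᵛ n f) ≡ SB.Σᵛ n (λ x → h (f x))
  Σᵛ-hom zero    f = refl
  Σᵛ-hom (suc n) f = trans (h-∙ _ _) (cong₂ _∘_ (Σᵛ-hom n _) (Σᵛ-hom n _))

  Σ<-hom : h ε ≡ ε′ → ∀ r (g : ℕ → A) → h (SA.Σ< r g) ≡ SB.Σ< r (λ i → h (g i))
  Σ<-hom h-ε zero    g = h-ε
  Σ<-hom h-ε (suc r) g = trans (h-∙ _ _) (cong (h (g 0) ∘_) (Σ<-hom h-ε r _))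

module FiniteSumLaws {A : Set} {_∙_ : Op₂ A} {ε : A} (isCM : IsCommutativeMonoid _≡_ _∙_ ε) where
  open FiniteSums _∙_ ε
  open IsCommutativeMonoid isCM using (identityˡ)
  private
    CM : CommutativeMonoid _ _
    CM = record { isCommutativeMonoid = isCM }
  open import Algebra.Properties.CommutativeSemigroup (CommutativeMonoid.commutativeSemigroup CM)
    using (interchange)

  Σᵛ-ε : ∀ n → Σᵛ n (λ _ → ε) ≡ ε
  Σᵛ-ε zero    = refl
  Σᵛ-ε (suc n) = trans (cong₂ _∙_ (Σᵛ-ε n) (Σᵛ-ε n)) (identityˡ ε)

  Σ<-ε : ∀ r → Σ< r (λ _ → ε) ≡ ε
  Σ<-ε zero    = refl
  Σ<-ε (suc r) = trans (cong (ε ∙_) (Σ<-ε r)) (identityˡ ε)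

  Σᵛ-∙ : ∀ n (f g : Vec Bool n → A) → Σᵛ n (λ x → f x ∙ g x) ≡ Σᵛ n f ∙ Σᵛ n g
  Σᵛ-∙ zero    f g = refl
  Σᵛ-∙ (suc n) f g = trans (cong₂ _∙_ (Σᵛ-∙ n _ _) (Σᵛ-∙ n _ _)) (interchange _ _ _ _)

  Σᵛ-swap : ∀ n p (f : Vec Bool n → Vec Bool p → A) →
            Σᵛ n (λ x → Σᵛ p (f x)) ≡ Σᵛ p (λ y → Σᵛ n (λ x → f x y))
  Σᵛ-swap zero    p f = refl
  Σᵛ-swap (suc n) p f = trans (cong₂ _∙_ (Σᵛ-swap n p _) (Σᵛ-swap n p _)) (sym (Σᵛ-∙ p _ _))

  Σᵛ-Σ< : ∀ n r (F : Vec Bool n → ℕ → A) → Σᵛ n (λ x → Σ< r (F x)) ≡ Σ< r (λ i → Σᵛ n (λ x → F x i))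
  Σᵛ-Σ< n zero    F = Σᵛ-ε n
  Σᵛ-Σ< n (suc r) F = trans (Σᵛ-∙ n _ _) (cong (Σᵛ n (λ x → F x 0) ∙_) (Σᵛ-Σ< n r (λ x i → F x (suc i))))

  Σᵛ-∷ʳ : ∀ n (f : Vec Bool (suc n) → A) →
          Σᵛ (suc n) f ≡ Σᵛ n (λ x → f (x ∷ʳ true)) ∙ Σᵛ n (λ x → f (x ∷ʳ false))
  Σᵛ-∷ʳ zero    f = refl
  Σᵛ-∷ʳ (suc n) f = trans (cong₂ _∙_ (Σᵛ-∷ʳ n (λ x → f (true ∷ x))) (Σᵛ-∷ʳ n (λ x → f (false ∷ x))))
                           (interchange _ _ _ _)

open FiniteSums _+_ 0
open FiniteSumLaws +-0-isCommutativeMonoid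

Σᵛ-*ˡ : ∀ n c (f : Vec Bool n → ℕ) → Σᵛ n (λ x → c * f x) ≡ c * Σᵛ n f
Σᵛ-*ˡ n c f = sym (Σᵛ-hom {ε = 0} {ε′ = 0} (c *_) (*-distribˡ-+ c) n f)

module +-CS = CSProperties +-commutativeSemigroup
module *-CS = CSProperties *-commutativeSemigroup

Σ<-*ʳ : ∀ r (g : ℕ → ℕ) c → Σ< r g * c ≡ Σ< r (λ i → g i * c)
Σ<-*ʳ r g c = Σ<-hom {_∙_ = _+_} {ε = 0} {_∘_ = _+_} (_* c) (*-distribʳ-+ c) refl r g

Σ<-const : ∀ r c (g : ℕ → ℕ) → (∀ i → i < r → g i ≡ c) → Σ< r g ≡ r * c
Σ<-const zero    c g e = refl
Σ<-const (suc r) c g e = cong₂ _+_ (e 0 (s≤s z≤n)) (Σ<-const r c _ (λ i i<r → e (suc i) (s≤s i<r)))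

⟦_⟧ : Bool → ℕ
⟦ true  ⟧ = 1
⟦ false ⟧ = 0

⟦∧⟧ : ∀ a b → ⟦ a ∧ b ⟧ ≡ ⟦ a ⟧ * ⟦ b ⟧
⟦∧⟧ true  b = sym (+-identityʳ ⟦ b ⟧)
⟦∧⟧ false b = refl

-- Membership of a natural number; positions outside the vector are absent.
at : ∀ {n} → Vec Bool n → ℕ → Bool
at []      _       = false
at (b ∷ x) zero    = b
at (b ∷ x) (suc p) = at x p

at-lookup : ∀ {n} (x : Vec Bool n) (i : Fin n) → lookup x i ≡ at x (toℕ i)
at-lookup (b ∷ x) Fin.zero    = refl
at-lookup (b ∷ x) (Fin.suc i) = at-lookup x i

at-tabulate : ∀ {n} (f : Fin n → Bool) p (p<n : p < n) → at (tabulate f) p ≡ f (fromℕ< p<n)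
at-tabulate {suc n} f zero    _         = refl
at-tabulate {suc n} f (suc p) (s≤s p<n) = at-tabulate (λ i → f (Fin.suc i)) p p<n

at-≥ : ∀ {n} (x : Vec Bool n) p → n ≤ p → at x p ≡ false
at-≥ []      p       _         = refl
at-≥ (b ∷ x) (suc p) (s≤s n≤p) = at-≥ x p n≤p

at-∷ʳ-< : ∀ {n} (x : Vec Bool n) b p → p < n → at (x ∷ʳ b) p ≡ at x p
at-∷ʳ-< (c ∷ x) b zero    _         = refl
at-∷ʳ-< (c ∷ x) b (suc p) (s≤s p<n) = at-∷ʳ-< x b p p<n

at-∷ʳ-last : ∀ {n} (x : Vec Bool n) b → at (x ∷ʳ b) n ≡ b
at-∷ʳ-last []      b = refl
at-∷ʳ-last (c ∷ x) b = at-∷ʳ-last x b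

at-++ˡ : ∀ {a b} (y : Vec Bool a) (z : Vec Bool b) p → p < a → at (y ++ z) p ≡ at y p
at-++ˡ (c ∷ y) z zero    _         = refl
at-++ˡ (c ∷ y) z (suc p) (s≤s p<a) = at-++ˡ y z p p<a

at-++ʳ : ∀ {a b} (y : Vec Bool a) (z : Vec Bool b) q → at (y ++ z) (a + q) ≡ at z q
at-++ʳ []      z q = refl
at-++ʳ (c ∷ y) z q = at-++ʳ y z q

size-∷ʳ : ∀ {n} (x : Vec Bool n) b → ∣ x ∷ʳ b ∣ ≡ ∣ b ∷ x ∣
size-∷ʳ []          b     = refl
size-∷ʳ (true ∷ x)  true  = cong suc (size-∷ʳ x true)
size-∷ʳ (true ∷ x)  false = cong suc (size-∷ʳ x false)
size-∷ʳ (false ∷ x) b     = size-∷ʳ x b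

size-++ : ∀ {a b} (y : Vec Bool a) (z : Vec Bool b) → ∣ y ++ z ∣ ≡ ∣ y ∣ + ∣ z ∣
size-++ []          z = refl
size-++ (true ∷ y)  z = cong suc (size-++ y z)
size-++ (false ∷ y) z = size-++ y z

size-ones : ∀ m → ∣ replicate m true ∣ ≡ m
size-ones zero    = refl
size-ones (suc m) = cong suc (size-ones m)

size-zeros : ∀ m → ∣ replicate m false ∣ ≡ 0
size-zeros zero    = refl
size-zeros (suc m) = size-zeros m

size-Σ< : ∀ {n} (x : Vec Bool n) → ∣ x ∣ ≡ Σ< n (λ p → ⟦ at x p ⟧)
size-Σ< []          = refl
size-Σ< (true ∷ x)  = cong suc (size-Σ< x)
size-Σ< (false ∷ x) = size-Σ< x

cycAt : ∀ {n} → Vec Bool (suc n) → ℕ → Bool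
cycAt {n} X a = at X (a % suc n)

cycAt-< : ∀ {n} (X : Vec Bool (suc n)) a → a < suc n → cycAt X a ≡ at X a
cycAt-< X a a<N = cong (at X) (m<n⇒m%n≡m a<N)

cycAt-period : ∀ {n} (X : Vec Bool (suc n)) a → cycAt X (a + suc n) ≡ cycAt X a
cycAt-period {n} X a = cong (at X) ([m+n]%n≡m%n a (suc n))

cycAt-% : ∀ {n} (X : Vec Bool (suc n)) a b → cycAt X (a % suc n + b) ≡ cycAt X (a + b)
cycAt-% {n} X a b = cong (at X) (begin
  (a % N + b) % N           ≡⟨ %-distribˡ-+ (a % N) b N ⟩
  (a % N % N + b % N) % N   ≡⟨ cong (λ z → (z + b % N) % N) (m%n%n≡m%n a N) ⟩
  (a % N + b % N) % N       ≡⟨ %-distribˡ-+ a b N ⟨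
  (a + b) % N               ∎)
  where open ≡-Reasoning
        N = suc n

-- Rotation of the cycle by one step: i ↦ i - 1.
rotate : ∀ {n} → Vec Bool (suc n) → Vec Bool (suc n)
rotate (b ∷ x) = x ∷ʳ b

size-rotate : ∀ {n} (x : Vec Bool (suc n)) → ∣ rotate x ∣ ≡ ∣ x ∣
size-rotate (b ∷ x) = size-∷ʳ x b

-- Rotation is a bijection of the cube, so sums are invariant under it.
Σᵛ-rotate : ∀ n (f : Vec Bool (suc n) → ℕ) → Σᵛ (suc n) (λ x → f (rotate x)) ≡ Σᵛ (suc n) f
Σᵛ-rotate n f = sym (Σᵛ-∷ʳ n f)

cycAt-rotate : ∀ {n} (X : Vec Bool (suc n)) a → cycAt (rotate X) a ≡ cycAt X (suc a)
cycAt-rotate {n} (b ∷ x) a with a % suc n in eq | m%n<n a (suc n)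
... | r | r<N = trans (shifted r r<N) (cong (at (b ∷ x)) (sym suc-mod))
  where
  suc-mod : suc a % suc n ≡ suc r % suc n
  suc-mod = begin
    suc a % suc n                             ≡⟨ cong (λ z → suc z % suc n) (m≡m%n+[m/n]*n a (suc n)) ⟩
    (suc (a % suc n) + (a ℕ./ suc n) * suc n) % suc n ≡⟨ [m+kn]%n≡m%n (suc (a % suc n)) (a ℕ./ suc n) (suc n) ⟩
    suc (a % suc n) % suc n                   ≡⟨ cong (λ z → suc z % suc n) eq ⟩
    suc r % suc n                             ∎
    where open ≡-Reasoning
  shifted : ∀ r → r < suc n → at (x ∷ʳ b) r ≡ at (b ∷ x) (suc r % suc n)
  shifted r r<N with r ℕ.<? n
  ... | yes r<n = trans (at-∷ʳ-< x b r r<n) (cong (at (b ∷ x)) (sym (m<n⇒m%n≡m (s≤s r<n))))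
  ... | no  r≮n rewrite ≤-antisym (≤-pred r<N) (≮⇒≥ r≮n) =
    trans (at-∷ʳ-last x b) (cong (at (b ∷ x)) (sym (n%n≡0 (suc n))))

allBelow : (ℕ → Bool) → ℕ → Bool
allBelow g zero    = true
allBelow g (suc r) = g 0 ∧ allBelow (λ i → g (suc i)) r

allBelow-cong : ∀ r {g h : ℕ → Bool} → (∀ i → i < r → g i ≡ h i) → allBelow g r ≡ allBelow h r
allBelow-cong zero    e = refl
allBelow-cong (suc r) e = cong₂ _∧_ (e 0 (s≤s z≤n)) (allBelow-cong r (λ i i<r → e (suc i) (s≤s i<r)))

allBelow-suc : ∀ r (g : ℕ → Bool) → allBelow g (suc r) ≡ allBelow g r ∧ g r
allBelow-suc zero    g with g 0
... | true  = refl
... | false = refl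
allBelow-suc (suc r) g with g 0
... | true  = allBelow-suc r (λ i → g (suc i))
... | false = refl

allBelow-+ : ∀ a b (g : ℕ → Bool) → allBelow g (a + b) ≡ allBelow g a ∧ allBelow (λ i → g (a + i)) b
allBelow-+ zero    b g = refl
allBelow-+ (suc a) b g with g 0
... | true  = allBelow-+ a b (λ i → g (suc i))
... | false = refl

allBelow-elim : ∀ r {g : ℕ → Bool} → allBelow g r ≡ true → ∀ i → i < r → g i ≡ true
allBelow-elim (suc r) {g} e i       _         with g 0 in g0
allBelow-elim (suc r)     e zero    _         | true = g0
allBelow-elim (suc r)     e (suc i) (s≤s i<r) | true = allBelow-elim r e i i<r

allBelow-intro : ∀ r {g : ℕ → Bool} → (∀ i → i < r → g i ≡ true) → allBelow g r ≡ true
allBelow-intro zero    h = refl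
allBelow-intro (suc r) h rewrite h 0 (s≤s z≤n) = allBelow-intro r (λ i i<r → h (suc i) (s≤s i<r))

allBelow-false : ∀ r {g : ℕ → Bool} i → i < r → g i ≡ false → allBelow g r ≡ false
allBelow-false (suc r)     zero    _         e rewrite e = refl
allBelow-false (suc r) {g} (suc i) (s≤s i<r) e with g 0
... | true  = allBelow-false r i i<r e
... | false = refl

-- Run starts

runStart : ℕ → (ℕ → Bool) → ℕ → Bool
runStart m f p = not (f p) ∧ allBelow (λ i → f (suc (p + i))) m

runStarts : ∀ {n} → ℕ → Vec Bool (suc n) → Vec Bool (suc n)
runStarts m S = tabulate (λ i → runStart m (cycAt S) (toℕ i))

at-runStarts : ∀ {n} m (S : Vec Bool (suc n)) p → p < suc n → at (runStarts m S) p ≡ runStart m (cycAt S) p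
at-runStarts m S p p<N =
  trans (at-tabulate (λ i → runStart m (cycAt S) (toℕ i)) p p<N) (cong (runStart m (cycAt S)) (toℕ-fromℕ< p<N))

runStart-period : ∀ {n} m (X : Vec Bool (suc n)) p → runStart m (cycAt X) (p + suc n) ≡ runStart m (cycAt X) p
runStart-period {n} m X p = cong₂ _∧_ (cong not (cycAt-period X p))
  (allBelow-cong m (λ i _ → trans (cong (cycAt X) (cong suc (+-CS.xy∙z≈xz∙y p (suc n) i))) (cycAt-period X (suc (p + i)))))

runStart-% : ∀ {n} m (X : Vec Bool (suc n)) p → runStart m (cycAt X) (p % suc n) ≡ runStart m (cycAt X) p
runStart-% {n} m X p = cong₂ _∧_
  (cong not (trans (cong (cycAt X) (sym (+-identityʳ (p % suc n)))) (trans (cycAt-% X p 0) (cong (cycAt X) (+-identityʳ p)))))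
  (allBelow-cong m (λ i _ → trans (cong (cycAt X) (sym (+-suc (p % suc n) i))) (trans (cycAt-% X p (suc i)) (cong (cycAt X) (+-suc p i)))))

-- A run of m ones preceded (at distance d) by a zero forces a run start:
-- walk back from the run to the last zero before it.
walkBack : ∀ m (f : ℕ → Bool) → 1 ≤ m → ∀ d a → f a ≡ false →
           (∀ j → j < m → f (a + d + j) ≡ true) → Σ ℕ λ p → runStart m f p ≡ true
walkBack m f 1≤m zero a fa run with trans (sym fa) (trans (cong f (sym (trans (+-identityʳ (a + 0)) (+-identityʳ a)))) (run 0 1≤m))
... | ()
walkBack m f 1≤m (suc d) a fa run with f (a + d) in fad
... | false = a + d , cong₂ _∧_ (cong not fad)
                (allBelow-intro m (λ i i<m → trans (cong (λ z → f (z + i)) (sym (+-suc a d))) (run i i<m)))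
... | true  = walkBack m f 1≤m d a fa run′
  where
  run′ : ∀ j → j < m → f (a + d + j) ≡ true
  run′ zero    _      = trans (cong f (+-identityʳ (a + d))) fad
  run′ (suc j) sj<m  = trans (cong f (trans (+-suc (a + d) j) (cong (_+ j) (sym (+-suc a d)))))
                             (run j (<-trans (n<1+n j) sj<m))

nonemptyᵇ : ∀ {n} → Vec Bool n → Bool
nonemptyᵇ []      = false
nonemptyᵇ (u ∷ U) = u ∨ nonemptyᵇ U

nonemptyᵇ-elim : ∀ {n} (U : Vec Bool n) → nonemptyᵇ U ≡ true → Σ ℕ λ p → p < n × at U p ≡ true
nonemptyᵇ-elim (true ∷ U)  e = 0 , s≤s z≤n , refl
nonemptyᵇ-elim (false ∷ U) e with nonemptyᵇ-elim U e
... | p , p<n , Up = suc p , s≤s p<n , Up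

nonemptyᵇ-intro : ∀ {n} (U : Vec Bool n) p → p < n → at U p ≡ true → nonemptyᵇ U ≡ true
nonemptyᵇ-intro (true ∷ U)  p       _         _  = refl
nonemptyᵇ-intro (false ∷ U) (suc p) (s≤s p<n) Up = nonemptyᵇ-intro U p p<n Up

missing : ∀ {n} (S : Vec Bool n) → ∣ S ∣ < n → Σ ℕ λ q → q < n × at S q ≡ false
missing (false ∷ S) _        = 0 , s≤s z≤n , refl
missing (true ∷ S)  (s≤s lt) with missing S lt
... | q , q<n , Sq = suc q , s≤s q<n , Sq

at-cyc : ∀ {n} (S : Vec Bool (suc n)) (i : Fin (suc n)) j → at S (toℕ (cyc i j)) ≡ cycAt S (toℕ i + j)
at-cyc {n} S i j = cong (at S) (toℕ-fromℕ< (m%n<n (toℕ i + j) (suc n)))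

∈⇒at : ∀ {n} (S : Vec Bool n) (i : Fin n) → i ∈ S → at S (toℕ i) ≡ true
∈⇒at S i i∈S = trans (sym (at-lookup S i)) ([]=⇒lookup i∈S)

at⇒∈ : ∀ {n} (S : Vec Bool n) (i : Fin n) → at S (toℕ i) ≡ true → i ∈ S
at⇒∈ S i Si = lookup⇒[]= i S (trans (at-lookup S i) Si)

does-reflects : ∀ {A : Set} (A? : Dec A) {b : Bool} → (A → b ≡ true) → (b ≡ true → A) → does A? ≡ b
does-reflects A? {true}  _ from = dec-true A? (from refl)
does-reflects A? {false} to _   = dec-false A? (λ a → case (to a))
  where case : false ≡ true → _
        case ()

module _ {n : ℕ} (m : ℕ) (1≤m : 1 ≤ m) (S : Vec Bool (suc n)) where
  private
    N = suc n

  hasRun⇒runStart : ∣ S ∣ < N → HasRun N m S → nonemptyᵇ (runStarts m S) ≡ true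
  hasRun⇒runStart proper (i , run∈S) with missing S proper
  ... | q , q<N , Sq = nonemptyᵇ-intro (runStarts m S) (p % N) (m%n<n p N)
                         (trans (at-runStarts m S (p % N) (m%n<n p N)) (trans (runStart-% m S p) p-start))
    where
    run : ∀ j → j < m → cycAt S (toℕ i + j) ≡ true
    run j j<m = trans (sym (trans (at-cyc S i (toℕ (fromℕ< j<m))) (cong (λ z → cycAt S (toℕ i + z)) (toℕ-fromℕ< j<m))))
                      (∈⇒at S (cyc i (toℕ (fromℕ< j<m))) (run∈S (fromℕ< j<m)))
    -- the missing vertex q, seen one lap earlier, lies at distance d before the run
    d = toℕ i + N ∸ q
    q+d : q + d ≡ toℕ i + N
    q+d = m+[n∸m]≡n (≤-trans (<⇒≤ q<N) (m≤n+m N (toℕ i)))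
    run′ : ∀ j → j < m → cycAt S (q + d + j) ≡ true
    run′ j j<m = begin
      cycAt S (q + d + j)       ≡⟨ cong (λ z → cycAt S (z + j)) q+d ⟩
      cycAt S (toℕ i + N + j)   ≡⟨ cong (cycAt S) (+-CS.xy∙z≈xz∙y (toℕ i) N j) ⟩
      cycAt S (toℕ i + j + N)   ≡⟨ cycAt-period S (toℕ i + j) ⟩
      cycAt S (toℕ i + j)       ≡⟨ run j j<m ⟩
      true                      ∎
      where open ≡-Reasoning
    start = walkBack m (cycAt S) 1≤m d q (trans (cycAt-< S q q<N) Sq) run′
    p = proj₁ start
    p-start = proj₂ start

  runStart⇒hasRun : nonemptyᵇ (runStarts m S) ≡ true → HasRun N m S
  runStart⇒hasRun e with nonemptyᵇ-elim (runStarts m S) e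
  ... | p , p<N , p∈U = suc p mod N , λ j → at⇒∈ S _ (begin
      at S (toℕ (cyc (suc p mod N) (toℕ j)))   ≡⟨ at-cyc S (suc p mod N) (toℕ j) ⟩
      cycAt S (toℕ (suc p mod N) + toℕ j)      ≡⟨ cong (λ z → cycAt S (z + toℕ j)) (toℕ-fromℕ< (m%n<n (suc p) N)) ⟩
      cycAt S (suc p % N + toℕ j)              ≡⟨ cycAt-% S (suc p) (toℕ j) ⟩
      cycAt S (suc p + toℕ j)                  ≡⟨ allBelow-elim m run (toℕ j) (toℕ<n j) ⟩
      true                                     ∎)
    where
    open ≡-Reasoning
    p-start : runStart m (cycAt S) p ≡ true
    p-start = trans (sym (at-runStarts m S p p<N)) p∈U
    run : allBelow (λ i → cycAt S (suc (p + i))) m ≡ true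
    run with cycAt S p | p-start
    ... | false | r = r

  does-hasRun : ∣ S ∣ < N → does (hasRun? N m S) ≡ nonemptyᵇ (runStarts m S)
  does-hasRun proper = does-reflects (hasRun? N m S) (hasRun⇒runStart proper) runStart⇒hasRun

-- Compatible pairs: T is a set of run starts of S

_⊆ᵇ_ : ∀ {n} → Vec Bool n → Vec Bool n → Bool
_⊆ᵇ_ {n} T U = allBelow (λ p → not (at T p) ∨ at U p) n

compatible : ∀ {n} → ℕ → Vec Bool (suc n) → Vec Bool (suc n) → Bool
compatible m S T = T ⊆ᵇ runStarts m S

compatible-cyc : ∀ {n} m (S T : Vec Bool (suc n)) →
                 compatible m S T ≡ allBelow (λ p → not (cycAt T p) ∨ runStart m (cycAt S) p) (suc n)
compatible-cyc {n} m S T = allBelow-cong (suc n) (λ p p<N →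
  cong₂ (λ a b → not a ∨ b) (sym (cycAt-< T p p<N)) (at-runStarts m S p p<N))

compatible-rotate : ∀ {n} m (S T : Vec Bool (suc n)) → compatible m (rotate S) (rotate T) ≡ compatible m S T
compatible-rotate {n} m S T = begin
  compatible m (rotate S) (rotate T)
    ≡⟨ compatible-cyc m (rotate S) (rotate T) ⟩
  allBelow (λ p → not (cycAt (rotate T) p) ∨ runStart m (cycAt (rotate S)) p) (suc n)
    ≡⟨ allBelow-cong (suc n) (λ p _ → cong₂ (λ a b → not a ∨ b) (cycAt-rotate T p)
         (cong₂ _∧_ (cong not (cycAt-rotate S p)) (allBelow-cong m (λ i _ → cycAt-rotate S (suc (p + i)))))) ⟩
  allBelow (λ p → h (suc p)) (suc n)
    ≡⟨ allBelow-suc n (λ p → h (suc p)) ⟩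
  allBelow (λ p → h (suc p)) n ∧ h (suc n)
    ≡⟨ cong (allBelow (λ p → h (suc p)) n ∧_) h-period ⟩
  allBelow (λ p → h (suc p)) n ∧ h 0
    ≡⟨ ∧-comm (allBelow (λ p → h (suc p)) n) (h 0) ⟩
  allBelow h (suc n)
    ≡⟨ compatible-cyc m S T ⟨
  compatible m S T ∎
  where
  open ≡-Reasoning
  h : ℕ → Bool
  h p = not (cycAt T p) ∨ runStart m (cycAt S) p
  h-period : h (suc n) ≡ h 0
  h-period = cong₂ (λ a b → not a ∨ b) (cycAt-period T 0) (runStart-period m S 0)

-- Inclusion–exclusion

module ℤΣ where
  open FiniteSums ℤ._+_ 0ℤ public
  open FiniteSumLaws ℤP.+-0-isCommutativeMonoid public

Σᵛ-*ˡᶻ : ∀ n c (f : Vec Bool n → ℤ) → ℤΣ.Σᵛ n (λ x → c ℤ.* f x) ≡ c ℤ.* ℤΣ.Σᵛ n f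
Σᵛ-*ˡᶻ n c f = sym (Σᵛ-hom {ε = 0ℤ} {ε′ = 0ℤ} (c ℤ.*_) (ℤP.*-distribˡ-+ c) n f)

Σ<-*ʳᶻ : ∀ r (g : ℕ → ℤ) c → ℤΣ.Σ< r g ℤ.* c ≡ ℤΣ.Σ< r (λ i → g i ℤ.* c)
Σ<-*ʳᶻ r g c = Σ<-hom {_∙_ = ℤ._+_} {ε = 0ℤ} {_∘_ = ℤ._+_} (ℤ._* c) (ℤP.*-distribʳ-+ c) (ℤP.*-zeroˡ c) r g

Σᵛ-pos : ∀ n (f : Vec Bool n → ℕ) → + Σᵛ n f ≡ ℤΣ.Σᵛ n (λ x → + f x)
Σᵛ-pos = Σᵛ-hom {ε = 0} {ε′ = 0ℤ} +_ ℤP.pos-+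

⟦_⟧ᶻ : Bool → ℤ
⟦ b ⟧ᶻ = + ⟦ b ⟧

ieSign : ℕ → ℤ
ieSign zero    = 0ℤ
ieSign (suc t) = -1ℤ ^ t

alternating-subsets : ∀ {n} (U : Vec Bool n) →
  ℤΣ.Σᵛ n (λ T → ⟦ T ⊆ᵇ U ⟧ᶻ ℤ.* (-1ℤ ^ ∣ T ∣)) ≡ 1ℤ - ⟦ nonemptyᵇ U ⟧ᶻ
alternating-subsets []            = refl
alternating-subsets {suc n} (true ∷ U) = begin
  ℤΣ.Σᵛ n (λ T → ⟦ T ⊆ᵇ U ⟧ᶻ ℤ.* (-1ℤ ℤ.* (-1ℤ ^ ∣ T ∣))) ℤ.+ ℤΣ.Σᵛ n (λ T → ⟦ T ⊆ᵇ U ⟧ᶻ ℤ.* (-1ℤ ^ ∣ T ∣))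
    ≡⟨ ℤΣ.Σᵛ-∙ n _ _ ⟨
  ℤΣ.Σᵛ n (λ T → ⟦ T ⊆ᵇ U ⟧ᶻ ℤ.* (-1ℤ ℤ.* (-1ℤ ^ ∣ T ∣)) ℤ.+ ⟦ T ⊆ᵇ U ⟧ᶻ ℤ.* (-1ℤ ^ ∣ T ∣))
    ≡⟨ ℤΣ.Σᵛ-cong n (λ T → cancel ⟦ T ⊆ᵇ U ⟧ᶻ (-1ℤ ^ ∣ T ∣)) ⟩
  ℤΣ.Σᵛ n (λ _ → 0ℤ)
    ≡⟨ ℤΣ.Σᵛ-ε n ⟩
  0ℤ ∎
  where
  open ≡-Reasoning
  cancel : ∀ a b → a ℤ.* (-1ℤ ℤ.* b) ℤ.+ a ℤ.* b ≡ 0ℤ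
  cancel = solve-∀
alternating-subsets {suc n} (false ∷ U) = begin
  ℤΣ.Σᵛ n (λ _ → 0ℤ) ℤ.+ ℤΣ.Σᵛ n (λ T → ⟦ T ⊆ᵇ U ⟧ᶻ ℤ.* (-1ℤ ^ ∣ T ∣))
    ≡⟨ cong₂ ℤ._+_ (ℤΣ.Σᵛ-ε n) refl ⟩
  0ℤ ℤ.+ ℤΣ.Σᵛ n (λ T → ⟦ T ⊆ᵇ U ⟧ᶻ ℤ.* (-1ℤ ^ ∣ T ∣))
    ≡⟨ ℤP.+-identityˡ _ ⟩
  ℤΣ.Σᵛ n (λ T → ⟦ T ⊆ᵇ U ⟧ᶻ ℤ.* (-1ℤ ^ ∣ T ∣))
    ≡⟨ alternating-subsets U ⟩
  1ℤ - ⟦ nonemptyᵇ U ⟧ᶻ ∎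
  where open ≡-Reasoning

inclusion-exclusion : ∀ {n} (U : Vec Bool n) →
  ℤΣ.Σᵛ n (λ T → ⟦ T ⊆ᵇ U ⟧ᶻ ℤ.* ieSign ∣ T ∣) ≡ ⟦ nonemptyᵇ U ⟧ᶻ
inclusion-exclusion []                = refl
inclusion-exclusion {suc n} (true ∷ U) = begin
  ℤΣ.Σᵛ n (λ T → ⟦ T ⊆ᵇ U ⟧ᶻ ℤ.* (-1ℤ ^ ∣ T ∣)) ℤ.+ ℤΣ.Σᵛ n (λ T → ⟦ T ⊆ᵇ U ⟧ᶻ ℤ.* ieSign ∣ T ∣)
    ≡⟨ cong₂ ℤ._+_ (alternating-subsets U) (inclusion-exclusion U) ⟩
  1ℤ - ⟦ nonemptyᵇ U ⟧ᶻ ℤ.+ ⟦ nonemptyᵇ U ⟧ᶻ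
    ≡⟨ telescope ⟦ nonemptyᵇ U ⟧ᶻ ⟩
  1ℤ ∎
  where
  open ≡-Reasoning
  telescope : ∀ a → 1ℤ - a ℤ.+ a ≡ 1ℤ
  telescope = solve-∀
inclusion-exclusion {suc n} (false ∷ U) = begin
  ℤΣ.Σᵛ n (λ _ → 0ℤ) ℤ.+ ℤΣ.Σᵛ n (λ T → ⟦ T ⊆ᵇ U ⟧ᶻ ℤ.* ieSign ∣ T ∣)
    ≡⟨ cong₂ ℤ._+_ (ℤΣ.Σᵛ-ε n) refl ⟩
  0ℤ ℤ.+ ℤΣ.Σᵛ n (λ T → ⟦ T ⊆ᵇ U ⟧ᶻ ℤ.* ieSign ∣ T ∣)
    ≡⟨ ℤP.+-identityˡ _ ⟩
  ℤΣ.Σᵛ n (λ T → ⟦ T ⊆ᵇ U ⟧ᶻ ℤ.* ieSign ∣ T ∣)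
    ≡⟨ inclusion-exclusion U ⟩
  ⟦ nonemptyᵇ U ⟧ᶻ ∎
  where open ≡-Reasoning

Σ<-select : ∀ t r (g : ℕ → ℤ) → t < r → ℤΣ.Σ< r (λ i → ⟦ t ≡ᵇ i ⟧ᶻ ℤ.* g i) ≡ g t
Σ<-select zero    (suc r) g _ = begin
  1ℤ ℤ.* g 0 ℤ.+ ℤΣ.Σ< r (λ i → 0ℤ)  ≡⟨ cong₂ ℤ._+_ (ℤP.*-identityˡ (g 0)) (ℤΣ.Σ<-ε r) ⟩
  g 0 ℤ.+ 0ℤ                          ≡⟨ ℤP.+-identityʳ (g 0) ⟩
  g 0                                 ∎
  where open ≡-Reasoning
Σ<-select (suc t) (suc r) g (s≤s t<r) = trans (ℤP.+-identityˡ _) (Σ<-select t r (λ i → g (suc i)) t<r)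

Σᵛ-bySize : ∀ n (g : ℕ → ℤ) (c : Vec Bool n → ℤ) →
  ℤΣ.Σᵛ n (λ T → g ∣ T ∣ ℤ.* c T) ≡ ℤΣ.Σ< (suc n) (λ t → g t ℤ.* ℤΣ.Σᵛ n (λ T → ⟦ ∣ T ∣ ≡ᵇ t ⟧ᶻ ℤ.* c T))
Σᵛ-bySize n g c = begin
  ℤΣ.Σᵛ n (λ T → g ∣ T ∣ ℤ.* c T)
    ≡⟨ ℤΣ.Σᵛ-cong n (λ T → cong (ℤ._* c T) (sym (Σ<-select ∣ T ∣ (suc n) g (s≤s (∣p∣≤n T))))) ⟩
  ℤΣ.Σᵛ n (λ T → ℤΣ.Σ< (suc n) (λ t → ⟦ ∣ T ∣ ≡ᵇ t ⟧ᶻ ℤ.* g t) ℤ.* c T)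
    ≡⟨ ℤΣ.Σᵛ-cong n (λ T → Σ<-*ʳᶻ (suc n) (λ t → ⟦ ∣ T ∣ ≡ᵇ t ⟧ᶻ ℤ.* g t) (c T)) ⟩
  ℤΣ.Σᵛ n (λ T → ℤΣ.Σ< (suc n) (λ t → ⟦ ∣ T ∣ ≡ᵇ t ⟧ᶻ ℤ.* g t ℤ.* c T))
    ≡⟨ ℤΣ.Σᵛ-Σ< n (suc n) (λ T t → ⟦ ∣ T ∣ ≡ᵇ t ⟧ᶻ ℤ.* g t ℤ.* c T) ⟩
  ℤΣ.Σ< (suc n) (λ t → ℤΣ.Σᵛ n (λ T → ⟦ ∣ T ∣ ≡ᵇ t ⟧ᶻ ℤ.* g t ℤ.* c T))
    ≡⟨ ℤΣ.Σ<-cong (suc n) (λ t _ → trans (ℤΣ.Σᵛ-cong n (λ T → swap ⟦ ∣ T ∣ ≡ᵇ t ⟧ᶻ (g t) (c T))) (Σᵛ-*ˡᶻ n (g t) (λ T → ⟦ ∣ T ∣ ≡ᵇ t ⟧ᶻ ℤ.* c T))) ⟩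
  ℤΣ.Σ< (suc n) (λ t → g t ℤ.* ℤΣ.Σᵛ n (λ T → ⟦ ∣ T ∣ ≡ᵇ t ⟧ᶻ ℤ.* c T)) ∎
  where
  open ≡-Reasoning
  swap : ∀ a b c → a ℤ.* b ℤ.* c ≡ b ℤ.* (a ℤ.* c)
  swap = solve-∀

covers : ∀ {n} → ℕ → ℕ → Vec Bool (suc n) → ℕ
covers {n} m k T = Σᵛ (suc n) (λ S → ⟦ ∣ S ∣ ≡ᵇ k ⟧ * ⟦ compatible m S T ⟧)

-- weight n m k t = Σ_{|T| = t} covers m k T, for subsets T of the cycle ℤ/(n+1).
weight : (n m k t : ℕ) → ℕ
weight n m k t = Σᵛ (suc n) (λ T → ⟦ ∣ T ∣ ≡ᵇ t ⟧ * covers m k T)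

length-filter : ∀ {A : Set} {P : A → Set} (P? : Decidable P) (xs : List A) →
  length (filter P? xs) ≡ sum (List.map (λ x → ⟦ does (P? x) ⟧) xs)
length-filter P? List.[]         = refl
length-filter P? (x List.∷ xs) with does (P? x)
... | true  = cong suc (length-filter P? xs)
... | false = length-filter P? xs

sum-allSubsets : ∀ n (f : Vec Bool n → ℕ) → sum (List.map f (allSubsets n)) ≡ Σᵛ n f
sum-allSubsets zero    f = +-identityʳ (f [])
sum-allSubsets (suc n) f = begin
  sum (List.map f (List.map (true ∷_) (allSubsets n) List.++ List.map (false ∷_) (allSubsets n)))
    ≡⟨ cong sum (map-++ f (List.map (true ∷_) (allSubsets n)) _) ⟩
  sum (List.map f (List.map (true ∷_) (allSubsets n)) List.++ List.map f (List.map (false ∷_) (allSubsets n)))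
    ≡⟨ sum-++ (List.map f (List.map (true ∷_) (allSubsets n))) _ ⟩
  sum (List.map f (List.map (true ∷_) (allSubsets n))) + sum (List.map f (List.map (false ∷_) (allSubsets n)))
    ≡⟨ cong₂ _+_ (trans (cong sum (sym (map-∘ (allSubsets n)))) (sum-allSubsets n _))
                  (trans (cong sum (sym (map-∘ (allSubsets n)))) (sum-allSubsets n _)) ⟩
  Σᵛ (suc n) f ∎
  where open ≡-Reasoning

good-indicator : ∀ {n} m k (S : Vec Bool (suc n)) → k < suc n → 1 ≤ m →
  ⟦ does (good? (suc n) m k S) ⟧ ≡ ⟦ ∣ S ∣ ≡ᵇ k ⟧ * ⟦ nonemptyᵇ (runStarts m S) ⟧
good-indicator {n} m k S k<N 1≤m with ∣ S ∣ ≡ᵇ k in size≡k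
... | false = refl
... | true  = trans (cong ⟦_⟧ (does-hasRun m 1≤m S proper)) (sym (*-identityˡ _))
  where
  proper : ∣ S ∣ < suc n
  proper = subst (_< suc n) (sym (≡ᵇ⇒≡ ∣ S ∣ k (subst T (sym size≡k) _))) k<N

count-runStarts : ∀ n m k → k < suc n → 1 ≤ m →
  count (suc n) m k ≡ Σᵛ (suc n) (λ S → ⟦ ∣ S ∣ ≡ᵇ k ⟧ * ⟦ nonemptyᵇ (runStarts m S) ⟧)
count-runStarts n m k k<N 1≤m = begin
  count (suc n) m k
    ≡⟨ length-filter (good? (suc n) m k) (allSubsets (suc n)) ⟩
  sum (List.map (λ S → ⟦ does (good? (suc n) m k S) ⟧) (allSubsets (suc n)))
    ≡⟨ sum-allSubsets (suc n) (λ S → ⟦ does (good? (suc n) m k S) ⟧) ⟩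
  Σᵛ (suc n) (λ S → ⟦ does (good? (suc n) m k S) ⟧)
    ≡⟨ Σᵛ-cong (suc n) (λ S → good-indicator m k S k<N 1≤m) ⟩
  Σᵛ (suc n) (λ S → ⟦ ∣ S ∣ ≡ᵇ k ⟧ * ⟦ nonemptyᵇ (runStarts m S) ⟧) ∎
  where open ≡-Reasoning

Σ-compatible-sets : ∀ {n} m k (T : Vec Bool (suc n)) c →
  ℤΣ.Σᵛ (suc n) (λ S → ⟦ ∣ S ∣ ≡ᵇ k ⟧ᶻ ℤ.* (⟦ compatible m S T ⟧ᶻ ℤ.* c)) ≡ c ℤ.* + covers m k T
Σ-compatible-sets {n} m k T c = begin
  ℤΣ.Σᵛ N (λ S → ⟦ ∣ S ∣ ≡ᵇ k ⟧ᶻ ℤ.* (⟦ compatible m S T ⟧ᶻ ℤ.* c))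
    ≡⟨ ℤΣ.Σᵛ-cong N (λ S → trans (rearrange ⟦ ∣ S ∣ ≡ᵇ k ⟧ᶻ ⟦ compatible m S T ⟧ᶻ c)
                                  (cong (c ℤ.*_) (sym (ℤP.pos-* ⟦ ∣ S ∣ ≡ᵇ k ⟧ ⟦ compatible m S T ⟧)))) ⟩
  ℤΣ.Σᵛ N (λ S → c ℤ.* + (⟦ ∣ S ∣ ≡ᵇ k ⟧ * ⟦ compatible m S T ⟧))
    ≡⟨ Σᵛ-*ˡᶻ N c (λ S → + (⟦ ∣ S ∣ ≡ᵇ k ⟧ * ⟦ compatible m S T ⟧)) ⟩
  c ℤ.* ℤΣ.Σᵛ N (λ S → + (⟦ ∣ S ∣ ≡ᵇ k ⟧ * ⟦ compatible m S T ⟧))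
    ≡⟨ cong (c ℤ.*_) (Σᵛ-pos N (λ S → ⟦ ∣ S ∣ ≡ᵇ k ⟧ * ⟦ compatible m S T ⟧)) ⟨
  c ℤ.* + covers m k T ∎
  where
  open ≡-Reasoning
  N = suc n
  rearrange : ∀ a b c → a ℤ.* (b ℤ.* c) ≡ c ℤ.* (a ℤ.* b)
  rearrange = solve-∀

-- Summing inclusion–exclusion over all k-sets S and exchanging the sums.
count-alternating : ∀ n m k → k < suc n → 1 ≤ m →
  + count (suc n) m k ≡ ℤΣ.Σ< (suc n) (λ i → (-1ℤ ^ i) ℤ.* + weight n m k (suc i))
count-alternating n m k k<N 1≤m = begin
  + count N m k
    ≡⟨ cong +_ (count-runStarts n m k k<N 1≤m) ⟩
  + Σᵛ N (λ S → ⟦ ∣ S ∣ ≡ᵇ k ⟧ * ⟦ nonemptyᵇ (runStarts m S) ⟧)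
    ≡⟨ Σᵛ-pos N (λ S → ⟦ ∣ S ∣ ≡ᵇ k ⟧ * ⟦ nonemptyᵇ (runStarts m S) ⟧) ⟩
  ℤΣ.Σᵛ N (λ S → + (⟦ ∣ S ∣ ≡ᵇ k ⟧ * ⟦ nonemptyᵇ (runStarts m S) ⟧))
    ≡⟨ ℤΣ.Σᵛ-cong N (λ S → trans (ℤP.pos-* ⟦ ∣ S ∣ ≡ᵇ k ⟧ ⟦ nonemptyᵇ (runStarts m S) ⟧) (cong (⟦ ∣ S ∣ ≡ᵇ k ⟧ᶻ ℤ.*_) (sym (inclusion-exclusion (runStarts m S))))) ⟩
  ℤΣ.Σᵛ N (λ S → ⟦ ∣ S ∣ ≡ᵇ k ⟧ᶻ ℤ.* ℤΣ.Σᵛ N (λ T → ⟦ compatible m S T ⟧ᶻ ℤ.* ieSign ∣ T ∣))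
    ≡⟨ ℤΣ.Σᵛ-cong N (λ S → sym (Σᵛ-*ˡᶻ N ⟦ ∣ S ∣ ≡ᵇ k ⟧ᶻ (λ T → ⟦ compatible m S T ⟧ᶻ ℤ.* ieSign ∣ T ∣))) ⟩
  ℤΣ.Σᵛ N (λ S → ℤΣ.Σᵛ N (λ T → ⟦ ∣ S ∣ ≡ᵇ k ⟧ᶻ ℤ.* (⟦ compatible m S T ⟧ᶻ ℤ.* ieSign ∣ T ∣)))
    ≡⟨ ℤΣ.Σᵛ-swap N N (λ S T → ⟦ ∣ S ∣ ≡ᵇ k ⟧ᶻ ℤ.* (⟦ compatible m S T ⟧ᶻ ℤ.* ieSign ∣ T ∣)) ⟩
  ℤΣ.Σᵛ N (λ T → ℤΣ.Σᵛ N (λ S → ⟦ ∣ S ∣ ≡ᵇ k ⟧ᶻ ℤ.* (⟦ compatible m S T ⟧ᶻ ℤ.* ieSign ∣ T ∣)))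
    ≡⟨ ℤΣ.Σᵛ-cong N (λ T → Σ-compatible-sets m k T (ieSign ∣ T ∣)) ⟩
  ℤΣ.Σᵛ N (λ T → ieSign ∣ T ∣ ℤ.* + covers m k T)
    ≡⟨ Σᵛ-bySize N ieSign (λ T → + covers m k T) ⟩
  ℤΣ.Σ< (suc N) (λ t → ieSign t ℤ.* ℤΣ.Σᵛ N (λ T → ⟦ ∣ T ∣ ≡ᵇ t ⟧ᶻ ℤ.* + covers m k T))
    ≡⟨ ℤΣ.Σ<-cong (suc N) (λ t _ → cong (ieSign t ℤ.*_) (sym (weight-pos t))) ⟩
  0ℤ ℤ.+ ℤΣ.Σ< N (λ i → (-1ℤ ^ i) ℤ.* + weight n m k (suc i))
    ≡⟨ ℤP.+-identityˡ _ ⟩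
  ℤΣ.Σ< N (λ i → (-1ℤ ^ i) ℤ.* + weight n m k (suc i)) ∎
  where
  open ≡-Reasoning
  N = suc n
  weight-pos : ∀ t → + weight n m k t ≡ ℤΣ.Σᵛ N (λ T → ⟦ ∣ T ∣ ≡ᵇ t ⟧ᶻ ℤ.* + covers m k T)
  weight-pos t = trans (Σᵛ-pos N (λ T → ⟦ ∣ T ∣ ≡ᵇ t ⟧ * covers m k T))
                       (ℤΣ.Σᵛ-cong N (λ T → ℤP.pos-* ⟦ ∣ T ∣ ≡ᵇ t ⟧ (covers m k T)))

-- Rotation: counting with a marked vertex

covers-rotate : ∀ {n} m k (T : Vec Bool (suc n)) → covers m k (rotate T) ≡ covers m k T
covers-rotate {n} m k T = begin
  Σᵛ (suc n) (λ S → ⟦ ∣ S ∣ ≡ᵇ k ⟧ * ⟦ compatible m S (rotate T) ⟧)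
    ≡⟨ Σᵛ-rotate n (λ S → ⟦ ∣ S ∣ ≡ᵇ k ⟧ * ⟦ compatible m S (rotate T) ⟧) ⟨
  Σᵛ (suc n) (λ S → ⟦ ∣ rotate S ∣ ≡ᵇ k ⟧ * ⟦ compatible m (rotate S) (rotate T) ⟧)
    ≡⟨ Σᵛ-cong (suc n) (λ S → cong₂ (λ a b → ⟦ a ≡ᵇ k ⟧ * ⟦ b ⟧) (size-rotate S) (compatible-rotate m S T)) ⟩
  Σᵛ (suc n) (λ S → ⟦ ∣ S ∣ ≡ᵇ k ⟧ * ⟦ compatible m S T ⟧) ∎
  where open ≡-Reasoning

at-rotate : ∀ {n} (T : Vec Bool (suc n)) p → suc p < suc n → at (rotate T) p ≡ at T (suc p)
at-rotate T p sp<N = begin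
  at (rotate T) p       ≡⟨ cycAt-< (rotate T) p (<-trans (n<1+n p) sp<N) ⟨
  cycAt (rotate T) p    ≡⟨ cycAt-rotate T p ⟩
  cycAt T (suc p)       ≡⟨ cycAt-< T (suc p) sp<N ⟩
  at T (suc p)          ∎
  where open ≡-Reasoning

through : (n m k t p : ℕ) → ℕ
through n m k t p = Σᵛ (suc n) (λ T → ⟦ at T p ⟧ * (⟦ ∣ T ∣ ≡ᵇ t ⟧ * covers m k T))

-- By rotation invariance, this does not depend on the marked vertex p.
through-const : ∀ n m k t p → p < suc n → through n m k t p ≡ through n m k t 0
through-const n m k t zero    _    = refl
through-const n m k t (suc p) sp<N = trans step (through-const n m k t p (<-trans (n<1+n p) sp<N))
  where
  marked : Vec Bool (suc n) → ℕ → ℕ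
  marked T q = ⟦ at T q ⟧ * (⟦ ∣ T ∣ ≡ᵇ t ⟧ * covers m k T)
  marked-rotate : ∀ T → marked (rotate T) p ≡ marked T (suc p)
  marked-rotate T = cong₂ (λ a c → ⟦ a ⟧ * c) (at-rotate T p sp<N)
                          (cong₂ (λ s c → ⟦ s ≡ᵇ t ⟧ * c) (size-rotate T) (covers-rotate m k T))
  step : through n m k t (suc p) ≡ through n m k t p
  step = trans (Σᵛ-cong (suc n) (λ T → sym (marked-rotate T))) (Σᵛ-rotate n (λ T → marked T p))

-- Double counting the pairs (T, p) with p ∈ T: t · weight(t) = N · through(t, 0).
weight-rotation : ∀ n m k t → t * weight n m k t ≡ suc n * through n m k t 0
weight-rotation n m k t = begin
  t * weight n m k t
    ≡⟨ Σᵛ-*ˡ N t (λ T → ⟦ ∣ T ∣ ≡ᵇ t ⟧ * covers m k T) ⟨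
  Σᵛ N (λ T → t * (⟦ ∣ T ∣ ≡ᵇ t ⟧ * covers m k T))
    ≡⟨ Σᵛ-cong N (λ T → trans (size-scale ∣ T ∣ t (covers m k T)) (cong (_* (⟦ ∣ T ∣ ≡ᵇ t ⟧ * covers m k T)) (size-Σ< T))) ⟩
  Σᵛ N (λ T → Σ< N (λ p → ⟦ at T p ⟧) * (⟦ ∣ T ∣ ≡ᵇ t ⟧ * covers m k T))
    ≡⟨ Σᵛ-cong N (λ T → Σ<-*ʳ N (λ p → ⟦ at T p ⟧) (⟦ ∣ T ∣ ≡ᵇ t ⟧ * covers m k T)) ⟩
  Σᵛ N (λ T → Σ< N (λ p → ⟦ at T p ⟧ * (⟦ ∣ T ∣ ≡ᵇ t ⟧ * covers m k T)))
    ≡⟨ Σᵛ-Σ< N N (λ T p → ⟦ at T p ⟧ * (⟦ ∣ T ∣ ≡ᵇ t ⟧ * covers m k T)) ⟩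
  Σ< N (through n m k t)
    ≡⟨ Σ<-const N (through n m k t 0) (through n m k t) (through-const n m k t) ⟩
  N * through n m k t 0 ∎
  where
  open ≡-Reasoning
  N = suc n
  size-scale : ∀ a t x → t * (⟦ a ≡ᵇ t ⟧ * x) ≡ a * (⟦ a ≡ᵇ t ⟧ * x)
  size-scale a t x with a ≡ᵇ t in a≡t
  ... | false = trans (*-zeroʳ t) (sym (*-zeroʳ a))
  ... | true  = cong (_* (1 * x)) (sym (≡ᵇ⇒≡ a t (subst T (sym a≡t) _)))

-- Cutting the cycle open: compatible pairs on a path

-- Two predicates that agree below L and both fail at L have the same
-- conjunction over every window starting at or before L: such a window
-- either stays below L or fails at L in both cases.
allBelow-window : ∀ (g g′ : ℕ → Bool) L → (∀ i → i < L → g i ≡ g′ i) → g L ≡ false → g′ L ≡ false →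
                  ∀ r a → a ≤ L → allBelow (λ i → g (a + i)) r ≡ allBelow (λ i → g′ (a + i)) r
allBelow-window g g′ L agree gL g′L zero    a _   = refl
allBelow-window g g′ L agree gL g′L (suc r) a a≤L with m≤n⇒m<n∨m≡n a≤L
... | inj₁ a<L = cong₂ _∧_ (agree (a + 0) (subst (_< L) (sym (+-identityʳ a)) a<L)) (begin
  allBelow (λ i → g (a + suc i)) r    ≡⟨ allBelow-cong r (λ i _ → cong g (+-suc a i)) ⟩
  allBelow (λ i → g (suc a + i)) r    ≡⟨ allBelow-window g g′ L agree gL g′L r (suc a) a<L ⟩
  allBelow (λ i → g′ (suc a + i)) r   ≡⟨ allBelow-cong r (λ i _ → cong g′ (sym (+-suc a i))) ⟩
  allBelow (λ i → g′ (a + suc i)) r   ∎)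
  where open ≡-Reasoning
... | inj₂ refl rewrite +-identityʳ a | gL | g′L = refl

-- Linear compatibility on a path of L vertices: every vertex of T starts
-- a block "0 1ᵐ" of S, vertices beyond the end of the path being absent.
linCompatible : ∀ {L} → ℕ → Vec Bool L → Vec Bool L → Bool
linCompatible {L} m S T = allBelow (λ q → not (at T q) ∨ runStart m (at S) q) L

-- If vertex 0 is not in S, no block of S wraps around, so cyclic and
-- linear compatibility coincide.
compatible-linear : ∀ {n} m (S T : Vec Bool (suc n)) → at S 0 ≡ false → compatible m S T ≡ linCompatible m S T
compatible-linear {n} m S T S0 = trans (compatible-cyc m S T) (allBelow-cong N (λ p p<N →
  cong₂ (λ a b → not a ∨ b) (cycAt-< T p p<N)
    (cong₂ _∧_ (cong not (cycAt-< S p p<N))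
      (allBelow-window (cycAt S) (at S) N (λ i i<N → cycAt-< S i i<N) (trans (cong (at S) (n%n≡0 N)) S0)
                       (at-≥ S N ≤-refl) m (suc p) p<N))))
  where N = suc n

linCount : ℕ → ℕ → ℕ → ℕ → ℕ
linCount m L i j = Σᵛ L (λ T → ⟦ ∣ T ∣ ≡ᵇ i ⟧ * Σᵛ L (λ S → ⟦ ∣ S ∣ ≡ᵇ j ⟧ * ⟦ linCompatible m S T ⟧))

-- The same count on a path of L + 1 vertices whose first vertex is in T
-- (and hence not in S), with |T| = i + 1 and |S| = j.
headed : ℕ → ℕ → ℕ → ℕ → ℕ
headed m L i j = Σᵛ L (λ T → ⟦ ∣ T ∣ ≡ᵇ i ⟧ * Σᵛ L (λ S → ⟦ ∣ S ∣ ≡ᵇ j ⟧ * ⟦ linCompatible m (false ∷ S) (true ∷ T) ⟧))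

compatible-head : ∀ {n} m (S T : Vec Bool n) → compatible m (true ∷ S) (true ∷ T) ≡ false
compatible-head m S T = compatible-cyc m (true ∷ S) (true ∷ T)

-- If vertex 0 lies in T, the compatible sets S avoid 0, so compatibility
-- becomes linear.
covers-head : ∀ {n} m k (T : Vec Bool n) →
  covers m k (true ∷ T) ≡ Σᵛ n (λ S → ⟦ ∣ S ∣ ≡ᵇ k ⟧ * ⟦ linCompatible m (false ∷ S) (true ∷ T) ⟧)
covers-head {n} m k T = begin
  Σᵛ n (λ S → ⟦ ∣ true ∷ S ∣ ≡ᵇ k ⟧ * ⟦ compatible m (true ∷ S) (true ∷ T) ⟧)
    + Σᵛ n (λ S → ⟦ ∣ S ∣ ≡ᵇ k ⟧ * ⟦ compatible m (false ∷ S) (true ∷ T) ⟧)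
    ≡⟨ cong₂ _+_ (trans (Σᵛ-cong n (λ S → trans (cong (λ b → ⟦ ∣ true ∷ S ∣ ≡ᵇ k ⟧ * ⟦ b ⟧) (compatible-head m S T))
                                                (*-zeroʳ ⟦ ∣ true ∷ S ∣ ≡ᵇ k ⟧))) (Σᵛ-ε n))
                 (Σᵛ-cong n (λ S → cong (λ b → ⟦ ∣ S ∣ ≡ᵇ k ⟧ * ⟦ b ⟧) (compatible-linear m (false ∷ S) (true ∷ T) refl))) ⟩
  0 + Σᵛ n (λ S → ⟦ ∣ S ∣ ≡ᵇ k ⟧ * ⟦ linCompatible m (false ∷ S) (true ∷ T) ⟧) ∎
  where open ≡-Reasoning

-- Marking vertex 0 of T cuts the cycle open into a path starting at 0.
through-headed : ∀ n m k i → through n m k (suc i) 0 ≡ headed m n i k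
through-headed n m k i = begin
  Σᵛ n (λ T → 1 * (⟦ ∣ T ∣ ≡ᵇ i ⟧ * covers m k (true ∷ T))) + Σᵛ n (λ T → 0)
    ≡⟨ cong₂ _+_ (Σᵛ-cong n (λ T → trans (*-identityˡ _) (cong (⟦ ∣ T ∣ ≡ᵇ i ⟧ *_) (covers-head m k T)))) (Σᵛ-ε n) ⟩
  headed m n i k + 0
    ≡⟨ +-identityʳ _ ⟩
  headed m n i k ∎
  where open ≡-Reasoning

-- The recursion for compatible pairs on a path

atPred : (ℕ → ℕ) → ℕ → ℕ
atPred f zero    = 0
atPred f (suc i) = f i

-- Classify by the first vertex of the path: it lies in T (the headed
-- case; then it is not in S), in S only, or in neither.
linCount-suc : ∀ m L i j →
  linCount m (suc L) i j ≡ atPred (λ i′ → headed m L i′ j) i + (atPred (linCount m L i) j + linCount m L i j)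
linCount-suc m L i j = cong₂ _+_ (first-in-T i) first-not-in-T
  where
  first-in-T : ∀ i →
    Σᵛ L (λ T → ⟦ suc ∣ T ∣ ≡ᵇ i ⟧ * (Σᵛ L (λ S → ⟦ suc ∣ S ∣ ≡ᵇ j ⟧ * 0)
        + Σᵛ L (λ S → ⟦ ∣ S ∣ ≡ᵇ j ⟧ * ⟦ linCompatible m (false ∷ S) (true ∷ T) ⟧)))
    ≡ atPred (λ i′ → headed m L i′ j) i
  first-in-T zero     = Σᵛ-ε L
  first-in-T (suc i′) = Σᵛ-cong L (λ T → cong (⟦ ∣ T ∣ ≡ᵇ i′ ⟧ *_) (cong₂ _+_
                          (trans (Σᵛ-cong L (λ S → *-zeroʳ ⟦ suc ∣ S ∣ ≡ᵇ j ⟧)) (Σᵛ-ε L)) refl))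
  first-in-S : ∀ j → Σᵛ L (λ T → ⟦ ∣ T ∣ ≡ᵇ i ⟧ * Σᵛ L (λ S → ⟦ suc ∣ S ∣ ≡ᵇ j ⟧ * ⟦ linCompatible m S T ⟧))
                     ≡ atPred (linCount m L i) j
  first-in-S zero     = trans (Σᵛ-cong L (λ T → trans (cong (⟦ ∣ T ∣ ≡ᵇ i ⟧ *_) (Σᵛ-ε L)) (*-zeroʳ ⟦ ∣ T ∣ ≡ᵇ i ⟧))) (Σᵛ-ε L)
  first-in-S (suc j′) = refl
  first-not-in-T :
    Σᵛ L (λ T → ⟦ ∣ T ∣ ≡ᵇ i ⟧ * (Σᵛ L (λ S → ⟦ suc ∣ S ∣ ≡ᵇ j ⟧ * ⟦ linCompatible m S T ⟧)
        + Σᵛ L (λ S → ⟦ ∣ S ∣ ≡ᵇ j ⟧ * ⟦ linCompatible m S T ⟧)))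
    ≡ atPred (linCount m L i) j + linCount m L i j
  first-not-in-T = trans (Σᵛ-cong L (λ T → *-distribˡ-+ ⟦ ∣ T ∣ ≡ᵇ i ⟧ _ _))
                         (trans (Σᵛ-∙ L _ _) (cong (_+ linCount m L i j) (first-in-S j)))

allOnes : ∀ {m} → Vec Bool m → Bool
allOnes {m} y = allBelow (at y) m

allZeros : ∀ {m} → Vec Bool m → Bool
allZeros {m} y = allBelow (λ p → not (at y p)) m

Σᵛ-allOnes : ∀ m (h : Vec Bool m → ℕ) → Σᵛ m (λ y → ⟦ allOnes y ⟧ * h y) ≡ h (replicate m true)
Σᵛ-allOnes zero    h = +-identityʳ (h [])
Σᵛ-allOnes (suc m) h = trans (cong₂ _+_ (Σᵛ-allOnes m (λ y → h (true ∷ y))) (Σᵛ-ε m)) (+-identityʳ _)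

Σᵛ-allZeros : ∀ m (h : Vec Bool m → ℕ) → Σᵛ m (λ y → ⟦ allZeros y ⟧ * h y) ≡ h (replicate m false)
Σᵛ-allZeros zero    h = +-identityʳ (h [])
Σᵛ-allZeros (suc m) h = cong₂ _+_ (Σᵛ-ε m) (Σᵛ-allZeros m (λ y → h (false ∷ y)))

-- After a head vertex in T, S must continue with a block of m ones, which
-- in turn forces T to continue with a block of m zeros; after these blocks
-- the compatibility condition starts afresh.
linCompatible-blocks : ∀ {m L} (y y′ : Vec Bool m) (w w′ : Vec Bool L) →
  allBelow (at (y ++ w)) m ∧ linCompatible m (y ++ w) (y′ ++ w′) ≡ allOnes y ∧ (allZeros y′ ∧ linCompatible m w w′)
linCompatible-blocks {m} {L} y y′ w w′ = begin
  allBelow (at (y ++ w)) m ∧ linCompatible m (y ++ w) (y′ ++ w′)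
    ≡⟨ cong₂ _∧_ (allBelow-cong m (λ i i<m → at-++ˡ y w i i<m)) (allBelow-+ m L h) ⟩
  allOnes y ∧ (allBelow h m ∧ allBelow (λ q → h (m + q)) L)
    ≡⟨ given-ones (allOnes y) refl ⟩
  allOnes y ∧ (allZeros y′ ∧ linCompatible m w w′) ∎
  where
  open ≡-Reasoning
  h : ℕ → Bool
  h q = not (at (y′ ++ w′) q) ∨ runStart m (at (y ++ w)) q
  -- inside the block of ones no vertex of S is a run start
  inside : allOnes y ≡ true → allBelow h m ≡ allZeros y′
  inside ones = allBelow-cong m (λ p p<m → trans
    (cong₂ (λ a c → not a ∨ c) (at-++ˡ y′ w′ p p<m)
      (cong (λ a → not a ∧ allBelow (λ i → at (y ++ w) (suc (p + i))) m)
            (trans (at-++ˡ y w p p<m) (allBelow-elim m ones p p<m))))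
    (∨-identityʳ (not (at y′ p))))
  after : allBelow (λ q → h (m + q)) L ≡ linCompatible m w w′
  after = allBelow-cong L (λ q _ → cong₂ (λ a c → not a ∨ c) (at-++ʳ y′ w′ q)
    (cong₂ _∧_ (cong not (at-++ʳ y w q))
      (allBelow-cong m (λ i _ → trans (cong (at (y ++ w)) (trans (cong suc (+-assoc m q i)) (sym (+-suc m (q + i)))))
                                      (at-++ʳ y w (suc (q + i)))))))
  given-ones : ∀ a → a ≡ allOnes y → a ∧ (allBelow h m ∧ allBelow (λ q → h (m + q)) L) ≡ a ∧ (allZeros y′ ∧ linCompatible m w w′)
  given-ones false _    = refl
  given-ones true  ones = cong₂ _∧_ (inside (sym ones)) after

-- Removing the two forced blocks: a headed pair on a path of m + L + 1
-- vertices is an arbitrary pair on the last L vertices.  (The integrand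
-- of headed is definitionally allBelow (at S) m ∧ linCompatible m S T.)
headed-blocks : ∀ m L i j → headed m (m + L) i j ≡
  Σᵛ L (λ T → ⟦ ∣ T ∣ ≡ᵇ i ⟧ * Σᵛ L (λ S → ⟦ m + ∣ S ∣ ≡ᵇ j ⟧ * ⟦ linCompatible m S T ⟧))
headed-blocks m L i j = begin
  headed m (m + L) i j
    ≡⟨ Σᵛ-cong (m + L) (λ T → cong (⟦ ∣ T ∣ ≡ᵇ i ⟧ *_) (Σᵛ-++ m L (λ S → ⟦ ∣ S ∣ ≡ᵇ j ⟧ * ⟦ allBelow (at S) m ∧ linCompatible m S T ⟧))) ⟩
  Σᵛ (m + L) (λ T → ⟦ ∣ T ∣ ≡ᵇ i ⟧ * Σᵛ m (λ y → Σᵛ L (λ w → ⟦ ∣ y ++ w ∣ ≡ᵇ j ⟧ * ⟦ allBelow (at (y ++ w)) m ∧ linCompatible m (y ++ w) T ⟧)))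
    ≡⟨ Σᵛ-++ m L _ ⟩
  Σᵛ m (λ y′ → Σᵛ L (λ w′ → ⟦ ∣ y′ ++ w′ ∣ ≡ᵇ i ⟧ * Σᵛ m (λ y → Σᵛ L (λ w → ⟦ ∣ y ++ w ∣ ≡ᵇ j ⟧ * ⟦ allBelow (at (y ++ w)) m ∧ linCompatible m (y ++ w) (y′ ++ w′) ⟧))))
    ≡⟨ Σᵛ-cong m (λ y′ → Σᵛ-cong L (λ w′ → cong (⟦ ∣ y′ ++ w′ ∣ ≡ᵇ i ⟧ *_) (inner y′ w′))) ⟩
  Σᵛ m (λ y′ → Σᵛ L (λ w′ → ⟦ ∣ y′ ++ w′ ∣ ≡ᵇ i ⟧ * (⟦ allZeros y′ ⟧ * rest w′)))
    ≡⟨ Σᵛ-cong m (λ y′ → trans (Σᵛ-cong L (λ w′ → *-CS.x∙yz≈y∙xz ⟦ ∣ y′ ++ w′ ∣ ≡ᵇ i ⟧ ⟦ allZeros y′ ⟧ (rest w′)))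
                                (Σᵛ-*ˡ L ⟦ allZeros y′ ⟧ (λ w′ → ⟦ ∣ y′ ++ w′ ∣ ≡ᵇ i ⟧ * rest w′))) ⟩
  Σᵛ m (λ y′ → ⟦ allZeros y′ ⟧ * Σᵛ L (λ w′ → ⟦ ∣ y′ ++ w′ ∣ ≡ᵇ i ⟧ * rest w′))
    ≡⟨ Σᵛ-allZeros m (λ y′ → Σᵛ L (λ w′ → ⟦ ∣ y′ ++ w′ ∣ ≡ᵇ i ⟧ * rest w′)) ⟩
  Σᵛ L (λ w′ → ⟦ ∣ replicate m false ++ w′ ∣ ≡ᵇ i ⟧ * rest w′)
    ≡⟨ Σᵛ-cong L (λ w′ → cong (λ s → ⟦ s ≡ᵇ i ⟧ * rest w′) (trans (size-++ (replicate m false) w′) (cong (_+ ∣ w′ ∣) (size-zeros m)))) ⟩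
  Σᵛ L (λ w′ → ⟦ ∣ w′ ∣ ≡ᵇ i ⟧ * rest w′) ∎
  where
  open ≡-Reasoning
  rest : Vec Bool L → ℕ
  rest w′ = Σᵛ L (λ w → ⟦ m + ∣ w ∣ ≡ᵇ j ⟧ * ⟦ linCompatible m w w′ ⟧)
  inner : ∀ y′ w′ → Σᵛ m (λ y → Σᵛ L (λ w → ⟦ ∣ y ++ w ∣ ≡ᵇ j ⟧ * ⟦ allBelow (at (y ++ w)) m ∧ linCompatible m (y ++ w) (y′ ++ w′) ⟧))
                    ≡ ⟦ allZeros y′ ⟧ * rest w′
  inner y′ w′ = begin
    Σᵛ m (λ y → Σᵛ L (λ w → ⟦ ∣ y ++ w ∣ ≡ᵇ j ⟧ * ⟦ allBelow (at (y ++ w)) m ∧ linCompatible m (y ++ w) (y′ ++ w′) ⟧))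
      ≡⟨ Σᵛ-cong m (λ y → trans (Σᵛ-cong L (λ w → trans
             (cong (λ c → ⟦ ∣ y ++ w ∣ ≡ᵇ j ⟧ * c) (trans (cong ⟦_⟧ (linCompatible-blocks y y′ w w′)) (⟦∧⟧ (allOnes y) _)))
             (*-CS.x∙yz≈y∙xz ⟦ ∣ y ++ w ∣ ≡ᵇ j ⟧ ⟦ allOnes y ⟧ ⟦ allZeros y′ ∧ linCompatible m w w′ ⟧)))
           (Σᵛ-*ˡ L ⟦ allOnes y ⟧ (λ w → ⟦ ∣ y ++ w ∣ ≡ᵇ j ⟧ * ⟦ allZeros y′ ∧ linCompatible m w w′ ⟧))) ⟩
    Σᵛ m (λ y → ⟦ allOnes y ⟧ * Σᵛ L (λ w → ⟦ ∣ y ++ w ∣ ≡ᵇ j ⟧ * ⟦ allZeros y′ ∧ linCompatible m w w′ ⟧))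
      ≡⟨ Σᵛ-allOnes m (λ y → Σᵛ L (λ w → ⟦ ∣ y ++ w ∣ ≡ᵇ j ⟧ * ⟦ allZeros y′ ∧ linCompatible m w w′ ⟧)) ⟩
    Σᵛ L (λ w → ⟦ ∣ replicate m true ++ w ∣ ≡ᵇ j ⟧ * ⟦ allZeros y′ ∧ linCompatible m w w′ ⟧)
      ≡⟨ Σᵛ-cong L (λ w → trans (cong₂ (λ s c → ⟦ s ≡ᵇ j ⟧ * c)
                                  (trans (size-++ (replicate m true) w) (cong (_+ ∣ w ∣) (size-ones m)))
                                  (⟦∧⟧ (allZeros y′) _))
                   (*-CS.x∙yz≈y∙xz ⟦ m + ∣ w ∣ ≡ᵇ j ⟧ ⟦ allZeros y′ ⟧ ⟦ linCompatible m w w′ ⟧)) ⟩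
    Σᵛ L (λ w → ⟦ allZeros y′ ⟧ * (⟦ m + ∣ w ∣ ≡ᵇ j ⟧ * ⟦ linCompatible m w w′ ⟧))
      ≡⟨ Σᵛ-*ˡ L ⟦ allZeros y′ ⟧ _ ⟩
    ⟦ allZeros y′ ⟧ * rest w′ ∎

≡ᵇ-+ : ∀ m a b → (m + a ≡ᵇ m + b) ≡ (a ≡ᵇ b)
≡ᵇ-+ zero    a b = refl
≡ᵇ-+ (suc m) a b = ≡ᵇ-+ m a b

≡ᵇ-+-< : ∀ m a j → j < m → (m + a ≡ᵇ j) ≡ false
≡ᵇ-+-< (suc m) a zero    _         = refl
≡ᵇ-+-< (suc m) a (suc j) (s≤s j<m) = ≡ᵇ-+-< m a j j<m

headed-strip : ∀ m L i j → headed m (m + L) i (m + j) ≡ linCount m L i j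
headed-strip m L i j = trans (headed-blocks m L i (m + j))
  (Σᵛ-cong L (λ T → cong (⟦ ∣ T ∣ ≡ᵇ i ⟧ *_) (Σᵛ-cong L (λ S → cong (λ b → ⟦ b ⟧ * ⟦ linCompatible m S T ⟧) (≡ᵇ-+ m ∣ S ∣ j)))))

-- S must contain the block of m ones after the head vertex.
headed-low : ∀ m L i j → j < m → headed m (m + L) i j ≡ 0
headed-low m L i j j<m = trans (headed-blocks m L i j)
  (trans (Σᵛ-cong L (λ T → trans (cong (⟦ ∣ T ∣ ≡ᵇ i ⟧ *_)
           (trans (Σᵛ-cong L (λ S → cong (λ b → ⟦ b ⟧ * ⟦ linCompatible m S T ⟧) (≡ᵇ-+-< m ∣ S ∣ j j<m))) (Σᵛ-ε L)))
         (*-zeroʳ ⟦ ∣ T ∣ ≡ᵇ i ⟧))) (Σᵛ-ε L))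

-- The path must have room for that block.
headed-short : ∀ m L i j → L < m → headed m L i j ≡ 0
headed-short m L i j L<m = trans (Σᵛ-cong L (λ T → trans (cong (⟦ ∣ T ∣ ≡ᵇ i ⟧ *_)
    (trans (Σᵛ-cong L (λ S → trans (cong (λ b → ⟦ ∣ S ∣ ≡ᵇ j ⟧ * ⟦ b ∧ linCompatible m S T ⟧)
                                          (allBelow-false m L L<m (at-≥ S L ≤-refl)))
                                    (*-zeroʳ ⟦ ∣ S ∣ ≡ᵇ j ⟧))) (Σᵛ-ε L)))
    (*-zeroʳ ⟦ ∣ T ∣ ≡ᵇ i ⟧))) (Σᵛ-ε L)

headed-cases : ∀ m L i j →
  headed m L i j ≡ 0 ⊎ (m ≤ L × m ≤ j × headed m L i j ≡ linCount m (L ∸ m) i (j ∸ m))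
headed-cases m L i j with m ≤? L | m ≤? j
... | no  m≰L | _       = inj₁ (headed-short m L i j (≰⇒> m≰L))
... | yes m≤L | no  m≰j = inj₁ (subst (λ L → headed m L i j ≡ 0) (m+[n∸m]≡n m≤L) (headed-low m (L ∸ m) i j (≰⇒> m≰j)))
... | yes m≤L | yes m≤j = inj₂ (m≤L , m≤j , trans (cong₂ (λ L j → headed m L i j) (sym (m+[n∸m]≡n m≤L)) (sym (m+[n∸m]≡n m≤j)))
                                                   (headed-strip m (L ∸ m) i (j ∸ m)))

-- S needs m vertices after each vertex of T: no pairs with |S| < m·|T|.
-- (Induction on the length, bounded by B.)
linCount-few-S : ∀ m B L → L ≤ B → ∀ i j → j < m * i → linCount m L i j ≡ 0
linCount-few-S m B       zero    _         zero    j j<m0 rewrite *-zeroʳ m with j<m0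
... | ()
linCount-few-S m B       zero    _         (suc i) j _    = refl
linCount-few-S m (suc B) (suc L) (s≤s L≤B) i       j j<mi =
  trans (linCount-suc m L i j) (cong₂ _+_ (head i j<mi) (cong₂ _+_ (prev j j<mi) (linCount-few-S m B L L≤B i j j<mi)))
  where
  prev : ∀ j → j < m * i → atPred (linCount m L i) j ≡ 0
  prev zero     _  = refl
  prev (suc j′) lt = linCount-few-S m B L L≤B i j′ (<-trans (n<1+n j′) lt)
  head : ∀ i → j < m * i → atPred (λ i′ → headed m L i′ j) i ≡ 0
  head zero     _  = refl
  head (suc i′) lt with headed-cases m L i′ j
  ... | inj₁ vanishes                = vanishes
  ... | inj₂ (m≤L , m≤j , reduces)  = trans reduces
        (linCount-few-S m B (L ∸ m) (≤-trans (m∸n≤m L m) L≤B) i′ (j ∸ m)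
          (subst (j ∸ m <_) (m+n∸m≡n m (m * i′)) (∸-monoˡ-< (subst (j <_) (*-suc m i′) lt) m≤j)))

-- Each vertex of T is followed by m vertices of S: no pairs on paths of
-- fewer than |T| + m·|T| vertices.
linCount-short : ∀ m B L → L ≤ B → ∀ i j → L < i + m * i → linCount m L i j ≡ 0
linCount-short m B       zero    _         zero    j lt rewrite *-zeroʳ m with lt
... | ()
linCount-short m B       zero    _         (suc i) j _  = refl
linCount-short m (suc B) (suc L) (s≤s L≤B) i       j lt =
  trans (linCount-suc m L i j) (cong₂ _+_ (head i lt) (cong₂ _+_ (prev j) (linCount-short m B L L≤B i j shorter)))
  where
  shorter : L < i + m * i
  shorter = <-trans (n<1+n L) lt
  prev : ∀ j → atPred (linCount m L i) j ≡ 0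
  prev zero     = refl
  prev (suc j′) = linCount-short m B L L≤B i j′ shorter
  head : ∀ i → suc L < i + m * i → atPred (λ i′ → headed m L i′ j) i ≡ 0
  head zero     _  = refl
  head (suc i′) lt with headed-cases m L i′ j
  ... | inj₁ vanishes               = vanishes
  ... | inj₂ (m≤L , m≤j , reduces) = trans reduces
        (linCount-short m B (L ∸ m) (≤-trans (m∸n≤m L m) L≤B) i′ (j ∸ m)
          (subst (L ∸ m <_) (m+n∸m≡n m (i′ + m * i′)) (∸-monoˡ-< bound m≤L)))
    where
    bound : L < m + (i′ + m * i′)
    bound = subst (L <_) (trans (cong (λ x → i′ + x) (*-suc m i′)) (+-CS.x∙yz≈y∙xz i′ m (m * i′)))
                  (≤-pred lt)

-- Pascal's rule in the shape produced by linCount-suc.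
pascal : ∀ c u → suc c C u ≡ atPred (c C_) u + c C u
pascal c zero     = refl
pascal c (suc u′) = sym (nCk+nC[k+1]≡[n+1]C[k+1] c u′)

atPred-*ˡ : ∀ x (f : ℕ → ℕ) u → x * atPred f u ≡ atPred (λ u′ → x * f u′) u
atPred-*ˡ x f zero     = *-zeroʳ x
atPred-*ˡ x f (suc u′) = refl

-- The closed form of linCount: choose the i vertices of T among a
-- positions, then the u remaining vertices of S among the a - i others.
closedForm : ℕ → ℕ → ℕ → ℕ
closedForm a i u = (a C i) * ((a ∸ i) C u)

closedForm-suc : ∀ a i u → closedForm (suc a) i u ≡
  atPred (λ i′ → closedForm a i′ u) i + (atPred (closedForm a i) u + closedForm a i u)
closedForm-suc a zero u = begin
  1 * (suc a C u)                          ≡⟨ *-identityˡ _ ⟩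
  suc a C u                                ≡⟨ pascal a u ⟩
  atPred (a C_) u + a C u                  ≡⟨ cong₂ _+_ (*-identityˡ _) (*-identityˡ (a C u)) ⟨
  1 * atPred (a C_) u + 1 * (a C u)        ≡⟨ cong (_+ 1 * (a C u)) (atPred-*ˡ 1 (a C_) u) ⟩
  atPred (closedForm a 0) u + closedForm a 0 u ∎
  where open ≡-Reasoning
closedForm-suc a (suc i) u = begin
  (suc a C suc i) * ((a ∸ i) C u)
    ≡⟨ cong (_* ((a ∸ i) C u)) (nCk+nC[k+1]≡[n+1]C[k+1] a i) ⟨
  (a C i + a C suc i) * ((a ∸ i) C u)
    ≡⟨ *-distribʳ-+ ((a ∸ i) C u) (a C i) (a C suc i) ⟩
  closedForm a i u + (a C suc i) * ((a ∸ i) C u)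
    ≡⟨ cong (λ y → closedForm a i u + y) (shifted (suc i ≤? a)) ⟩
  closedForm a i u + (atPred (closedForm a (suc i)) u + closedForm a (suc i) u) ∎
  where
  open ≡-Reasoning
  x = a C suc i
  shifted : Dec (suc i ≤ a) → x * ((a ∸ i) C u) ≡ atPred (closedForm a (suc i)) u + closedForm a (suc i) u
  shifted (no i≥a) rewrite k>n⇒nCk≡0 (≰⇒> i≥a) = sym (vanishes u)
    where vanishes : ∀ u → atPred (λ _ → 0) u + 0 ≡ 0
          vanishes zero    = refl
          vanishes (suc _) = refl
  shifted (yes i<a) = begin
    x * ((a ∸ i) C u)                                   ≡⟨ cong (λ c → x * (c C u)) (+-∸-assoc 1 i<a) ⟩
    x * (suc (a ∸ suc i) C u)                           ≡⟨ cong (x *_) (pascal (a ∸ suc i) u) ⟩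
    x * (atPred ((a ∸ suc i) C_) u + (a ∸ suc i) C u)   ≡⟨ *-distribˡ-+ x _ _ ⟩
    x * atPred ((a ∸ suc i) C_) u + x * ((a ∸ suc i) C u) ≡⟨ cong (_+ x * ((a ∸ suc i) C u)) (atPred-*ˡ x _ u) ⟩
    atPred (closedForm a (suc i)) u + closedForm a (suc i) u ∎

-- linCount m L i j = C(L - m·i, i) · C(L - i - m·i, j - m·i), written with
-- a = L - m·i and u = j - m·i; induction on a via linCount-suc.
linCount-closed : ∀ m a i u → linCount m (a + m * i) i (u + m * i) ≡ closedForm a i u
linCount-closed m zero zero u rewrite *-zeroʳ m | +-identityʳ u with u
... | zero   = refl
... | suc _  = refl
linCount-closed m zero (suc i) u =
  linCount-short m (m * suc i) (m * suc i) ≤-refl (suc i) (u + m * suc i) (s≤s (m≤n+m (m * suc i) i))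
linCount-closed m (suc a) i u = begin
  linCount m (suc (a + m * i)) i (u + m * i)
    ≡⟨ linCount-suc m (a + m * i) i (u + m * i) ⟩
  atPred (λ i′ → headed m (a + m * i) i′ (u + m * i)) i
    + (atPred (linCount m (a + m * i) i) (u + m * i) + linCount m (a + m * i) i (u + m * i))
    ≡⟨ cong₂ _+_ (head i) (cong₂ _+_ (prev u) (linCount-closed m a i u)) ⟩
  atPred (λ i′ → closedForm a i′ u) i + (atPred (closedForm a i) u + closedForm a i u)
    ≡⟨ closedForm-suc a i u ⟨
  closedForm (suc a) i u ∎
  where
  open ≡-Reasoning
  prev : ∀ u → atPred (linCount m (a + m * i) i) (u + m * i) ≡ atPred (closedForm a i) u
  prev (suc u′) = linCount-closed m a i u′
  prev zero     with m * i in mi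
  ... | zero    = refl
  ... | suc j   = linCount-few-S m (a + suc j) (a + suc j) ≤-refl i j (≤-reflexive (sym mi))
  head : ∀ i → atPred (λ i′ → headed m (a + m * i) i′ (u + m * i)) i ≡ atPred (λ i′ → closedForm a i′ u) i
  head zero     = refl
  head (suc i′) = begin
    headed m (a + m * suc i′) i′ (u + m * suc i′)
      ≡⟨ cong₂ (λ L j → headed m L i′ j) (shift a) (shift u) ⟩
    headed m (m + (a + m * i′)) i′ (m + (u + m * i′))
      ≡⟨ headed-strip m (a + m * i′) i′ (u + m * i′) ⟩
    linCount m (a + m * i′) i′ (u + m * i′)
      ≡⟨ linCount-closed m a i′ u ⟩
    closedForm a i′ u ∎
    where
    shift : ∀ x → x + m * suc i′ ≡ m + (x + m * i′)
    shift x = trans (cong (λ y → x + y) (*-suc m i′)) (+-CS.x∙yz≈y∙xz x m (m * i′))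

-+-≥ : ∀ a b → b ≤ a → + a - + b ≡ + (a ∸ b)
-+-≥ a b b≤a = trans (ℤP.m-n≡m⊖n a b) (ℤP.⊖-≥ b≤a)

-+-< : ∀ a b → a < b → Σ ℕ λ c → + a - + b ≡ -[1+ c ]
-+-< a b a<b with b ∸ a in b∸a
... | zero  = ⊥-elim (m>n⇒m∸n≢0 a<b b∸a)
... | suc c = c , trans (ℤP.m-n≡m⊖n a b) (trans (ℤP.⊖-< a<b) (cong (λ x → ℤ.- (+ x)) b∸a))

binomℤ-negTop : ∀ a b y → a < b → binomℤ (+ a - + b) y ≡ 0
binomℤ-negTop a b y a<b with -+-< a b a<b
... | c , e rewrite e = refl

binomℤ-negBottom : ∀ x a b → a < b → binomℤ x (+ a - + b) ≡ 0
binomℤ-negBottom x a b a<b with -+-< a b a<b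
... | c , e rewrite e with x
... | + _      = refl
... | -[1+ _ ] = refl

linCount-binomℤ : ∀ m L i j →
  linCount m L i j ≡ binomℤ (+ L - + (m * i)) (+ i) * binomℤ (+ L - + (i + m * i)) (+ j - + (m * i))
linCount-binomℤ m L i j with m * i ≤? L | m * i ≤? j
... | no mi≰L | _ rewrite binomℤ-negTop L (m * i) (+ i) (≰⇒> mi≰L) =
  linCount-short m L L ≤-refl i j (<-≤-trans (≰⇒> mi≰L) (m≤n+m (m * i) i))
... | yes _ | no mi≰j rewrite binomℤ-negBottom (+ L - + (i + m * i)) j (m * i) (≰⇒> mi≰j) =
  trans (linCount-few-S m L L ≤-refl i j (≰⇒> mi≰j)) (sym (*-zeroʳ (binomℤ (+ L - + (m * i)) (+ i))))
... | yes mi≤L | yes mi≤j = begin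
  linCount m L i j                          ≡⟨ cong₂ (λ x y → linCount m x i y) (sym (m∸n+n≡m mi≤L)) (sym (m∸n+n≡m mi≤j)) ⟩
  linCount m (a + m * i) i (u + m * i)      ≡⟨ linCount-closed m a i u ⟩
  (a C i) * ((a ∸ i) C u)                    ≡⟨ as-binomℤ (i ≤? a) ⟩
  binomℤ (+ L - + (m * i)) (+ i) * binomℤ (+ L - + (i + m * i)) (+ j - + (m * i)) ∎
  where
  open ≡-Reasoning
  a = L ∸ m * i
  u = j ∸ m * i
  i+mi≤L : i ≤ a → i + m * i ≤ L
  i+mi≤L i≤a = subst (i + m * i ≤_) (m∸n+n≡m mi≤L) (+-monoˡ-≤ (m * i) i≤a)
  L∸[i+mi] : L ∸ (i + m * i) ≡ a ∸ i
  L∸[i+mi] = trans (cong (L ∸_) (+-comm i (m * i))) (sym (∸-+-assoc L (m * i) i))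
  as-binomℤ : Dec (i ≤ a) →
    (a C i) * ((a ∸ i) C u) ≡ binomℤ (+ L - + (m * i)) (+ i) * binomℤ (+ L - + (i + m * i)) (+ j - + (m * i))
  as-binomℤ (no i≰a) rewrite -+-≥ L (m * i) mi≤L | k>n⇒nCk≡0 (≰⇒> i≰a) = refl
  as-binomℤ (yes i≤a) rewrite -+-≥ L (m * i) mi≤L | -+-≥ j (m * i) mi≤j | -+-≥ L (i + m * i) (i+mi≤L i≤a) =
    cong (λ x → (a C i) * (x C u)) (sym L∸[i+mi])

-- The binomial arguments of Rterm for n = m + L + 1, k = m + j and t = i + 1.
top₁-arg : ∀ m L i → + suc (m + L) - + (m * suc i) - 1ℤ ≡ + L - + (m * i)
top₁-arg m L i = begin
  + suc (m + L) - + (m * suc i) - 1ℤ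
    ≡⟨ cong₂ (λ a b → a - b - 1ℤ) (trans (ℤP.pos-+ 1 (m + L)) (cong (λ x → 1ℤ ℤ.+ x) (ℤP.pos-+ m L)))
                                   (trans (ℤP.pos-* m (suc i)) (cong (+ m ℤ.*_) (ℤP.pos-+ 1 i))) ⟩
  1ℤ ℤ.+ (+ m ℤ.+ + L) - + m ℤ.* (1ℤ ℤ.+ + i) - 1ℤ
    ≡⟨ arith (+ m) (+ L) (+ i) ⟩
  + L - + m ℤ.* + i
    ≡⟨ cong (+ L -_) (ℤP.pos-* m i) ⟨
  + L - + (m * i) ∎
  where
  open ≡-Reasoning
  arith : ∀ M L I → 1ℤ ℤ.+ (M ℤ.+ L) - M ℤ.* (1ℤ ℤ.+ I) - 1ℤ ≡ L - M ℤ.* I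
  arith = solve-∀

top₂-arg : ∀ m L i → + suc (m + L) - + (suc m * suc i) ≡ + L - + (i + m * i)
top₂-arg m L i = begin
  + suc (m + L) - + (suc m * suc i)
    ≡⟨ cong₂ _-_ (trans (ℤP.pos-+ 1 (m + L)) (cong (λ x → 1ℤ ℤ.+ x) (ℤP.pos-+ m L)))
                 (trans (ℤP.pos-* (suc m) (suc i)) (cong₂ ℤ._*_ (ℤP.pos-+ 1 m) (ℤP.pos-+ 1 i))) ⟩
  1ℤ ℤ.+ (+ m ℤ.+ + L) - (1ℤ ℤ.+ + m) ℤ.* (1ℤ ℤ.+ + i)
    ≡⟨ arith (+ m) (+ L) (+ i) ⟩
  + L - (+ i ℤ.+ + m ℤ.* + i)
    ≡⟨ cong (+ L -_) (trans (ℤP.pos-+ i (m * i)) (cong (λ x → + i ℤ.+ x) (ℤP.pos-* m i))) ⟨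
  + L - + (i + m * i) ∎
  where
  open ≡-Reasoning
  arith : ∀ M L I → 1ℤ ℤ.+ (M ℤ.+ L) - (1ℤ ℤ.+ M) ℤ.* (1ℤ ℤ.+ I) ≡ L - (I ℤ.+ M ℤ.* I)
  arith = solve-∀

bottom₂-arg : ∀ m j i → + (m + j) - + (m * suc i) ≡ + j - + (m * i)
bottom₂-arg m j i = begin
  + (m + j) - + (m * suc i)
    ≡⟨ cong₂ _-_ (ℤP.pos-+ m j) (trans (ℤP.pos-* m (suc i)) (cong (+ m ℤ.*_) (ℤP.pos-+ 1 i))) ⟩
  + m ℤ.+ + j - + m ℤ.* (1ℤ ℤ.+ + i)
    ≡⟨ arith (+ m) (+ j) (+ i) ⟩
  + j - + m ℤ.* + i
    ≡⟨ cong (+ j -_) (ℤP.pos-* m i) ⟨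
  + j - + (m * i) ∎
  where
  open ≡-Reasoning
  arith : ∀ M J I → M ℤ.+ J - M ℤ.* (1ℤ ℤ.+ I) ≡ J - M ℤ.* I
  arith = solve-∀

weight-formula : ∀ m L j i →
  suc i * weight (m + L) m (m + j) (suc i) ≡
  suc (m + L) * (binomℤ (+ suc (m + L) - + (m * suc i) - 1ℤ) (+ i)
                 * binomℤ (+ suc (m + L) - + (suc m * suc i)) (+ (m + j) - + (m * suc i)))
weight-formula m L j i = begin
  suc i * weight (m + L) m (m + j) (suc i)
    ≡⟨ weight-rotation (m + L) m (m + j) (suc i) ⟩
  N * through (m + L) m (m + j) (suc i) 0
    ≡⟨ cong (N *_) (trans (through-headed (m + L) m (m + j) i) (headed-strip m L i j)) ⟩
  N * linCount m L i j
    ≡⟨ cong (N *_) (linCount-binomℤ m L i j) ⟩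
  N * (binomℤ (+ L - + (m * i)) (+ i) * binomℤ (+ L - + (i + m * i)) (+ j - + (m * i)))
    ≡⟨ cong (N *_) (cong₂ _*_ (cong (λ x → binomℤ x (+ i)) (top₁-arg m L i))
                              (cong₂ binomℤ (top₂-arg m L i) (bottom₂-arg m j i))) ⟨
  N * (binomℤ (+ N - + (m * suc i) - 1ℤ) (+ i) * binomℤ (+ N - + (suc m * suc i)) (+ (m + j) - + (m * suc i))) ∎
  where
  open ≡-Reasoning
  N = suc (m + L)

module ℚΣ = FiniteSums ℚ._+_ ℚ.0ℚ

/1-+ : ∀ a b → (a / 1) ℚ.+ (b / 1) ≡ (a ℤ.+ b) / 1
/1-+ a b = ℚP.toℚᵘ-injective (ℚᵘP.≃-trans (ℚP.toℚᵘ-homo-+ (a / 1) (b / 1))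
  (ℚᵘP.≃-trans (ℚᵘP.+-cong (ℚP.toℚᵘ-fromℚᵘ (mkℚᵘ a 0)) (ℚP.toℚᵘ-fromℚᵘ (mkℚᵘ b 0)))
  (ℚᵘP.≃-trans (*≡* (arith a b)) (ℚᵘP.≃-sym (ℚP.toℚᵘ-fromℚᵘ (mkℚᵘ (a ℤ.+ b) 0))))))
  where
  arith : ∀ a b → (a ℤ.* + 1 ℤ.+ b ℤ.* + 1) ℤ.* + 1 ≡ (a ℤ.+ b) ℤ.* (+ 1 ℤ.* + 1)
  arith = solve-∀

/-cancel : ∀ z t → (z ℤ.* + suc t) / suc t ≡ z / 1
/-cancel z t = ℚP.fromℚᵘ-cong {mkℚᵘ (z ℤ.* + suc t) t} {mkℚᵘ z 0} (*≡* (arith z (+ suc t)))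
  where
  arith : ∀ z T → z ℤ.* T ℤ.* + 1 ≡ z ℤ.* T
  arith = solve-∀

Σ<-/1 : ∀ r (g : ℕ → ℤ) → ℤΣ.Σ< r g / 1 ≡ ℚΣ.Σ< r (λ i → g i / 1)
Σ<-/1 = Σ<-hom {_∙_ = ℤ._+_} {_∘_ = ℚ._+_} (_/ 1) (λ a b → sym (/1-+ a b)) (ℚP.0/n≡0 1)

R-Σ< : ∀ m n k → R m n k ≡ ℚΣ.Σ< n (Rterm n m k)
R-Σ< m n k = foldr-applyUpTo (Rterm n m k) (λ i → i) n
  where
  foldr-applyUpTo : ∀ (g : ℕ → ℚ) (f : ℕ → ℕ) r →
    List.foldr ℚ._+_ ℚ.0ℚ (List.map g (List.applyUpTo f r)) ≡ ℚΣ.Σ< r (λ i → g (f i))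
  foldr-applyUpTo g f zero    = refl
  foldr-applyUpTo g f (suc r) = cong (g (f 0) ℚ.+_) (foldr-applyUpTo g (λ i → f (suc i)) r)

term-formula : ∀ m L j i → ((-1ℤ ^ i) ℤ.* + weight (m + L) m (m + j) (suc i)) / 1 ≡ Rterm (suc (m + L)) m (m + j) i
term-formula m L j i = begin
  ((-1ℤ ^ i) ℤ.* + W) / 1
    ≡⟨ /-cancel ((-1ℤ ^ i) ℤ.* + W) i ⟨
  ((-1ℤ ^ i) ℤ.* + W ℤ.* + suc i) / suc i
    ≡⟨ cong (_/ suc i) numerator ⟩
  Rterm N m (m + j) i ∎
  where
  open ≡-Reasoning
  N = suc (m + L)
  W = weight (m + L) m (m + j) (suc i)
  B₁ = binomℤ (+ N - + (m * suc i) - 1ℤ) (+ i)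
  B₂ = binomℤ (+ N - + (suc m * suc i)) (+ (m + j) - + (m * suc i))
  numerator : (-1ℤ ^ i) ℤ.* + W ℤ.* + suc i ≡ (-1ℤ ^ i) ℤ.* + N ℤ.* + B₁ ℤ.* + B₂
  numerator = begin
    (-1ℤ ^ i) ℤ.* + W ℤ.* + suc i       ≡⟨ arith₁ (-1ℤ ^ i) (+ W) (+ suc i) ⟩
    (-1ℤ ^ i) ℤ.* (+ suc i ℤ.* + W)     ≡⟨ cong ((-1ℤ ^ i) ℤ.*_) (sym (ℤP.pos-* (suc i) W)) ⟩
    (-1ℤ ^ i) ℤ.* + (suc i * W)         ≡⟨ cong (λ x → (-1ℤ ^ i) ℤ.* + x) (weight-formula m L j i) ⟩
    (-1ℤ ^ i) ℤ.* + (N * (B₁ * B₂))     ≡⟨ cong ((-1ℤ ^ i) ℤ.*_) (trans (ℤP.pos-* N (B₁ * B₂)) (cong (+ N ℤ.*_) (ℤP.pos-* B₁ B₂))) ⟩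
    (-1ℤ ^ i) ℤ.* (+ N ℤ.* (+ B₁ ℤ.* + B₂)) ≡⟨ arith₂ (-1ℤ ^ i) (+ N) (+ B₁) (+ B₂) ⟩
    (-1ℤ ^ i) ℤ.* + N ℤ.* + B₁ ℤ.* + B₂ ∎
    where
    arith₁ : ∀ s w t → s ℤ.* w ℤ.* t ≡ s ℤ.* (t ℤ.* w)
    arith₁ = solve-∀
    arith₂ : ∀ s a b c → s ℤ.* (a ℤ.* (b ℤ.* c)) ≡ s ℤ.* a ℤ.* b ℤ.* c
    arith₂ = solve-∀

count-formula : ∀ m L j → 1 ≤ m → j ≤ L → (+ count (suc (m + L)) m (m + j)) / 1 ≡ R m (suc (m + L)) (m + j)
count-formula m L j 1≤m j≤L = begin
  (+ count N m k) / 1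
    ≡⟨ cong (_/ 1) (count-alternating (m + L) m k (s≤s (+-monoʳ-≤ m j≤L)) 1≤m) ⟩
  ℤΣ.Σ< N (λ i → (-1ℤ ^ i) ℤ.* + weight (m + L) m k (suc i)) / 1
    ≡⟨ Σ<-/1 N (λ i → (-1ℤ ^ i) ℤ.* + weight (m + L) m k (suc i)) ⟩
  ℚΣ.Σ< N (λ i → ((-1ℤ ^ i) ℤ.* + weight (m + L) m k (suc i)) / 1)
    ≡⟨ ℚΣ.Σ<-cong N (λ i _ → term-formula m L j i) ⟩
  ℚΣ.Σ< N (Rterm N m k)
    ≡⟨ R-Σ< m N k ⟨
  R m N k ∎
  where
  open ≡-Reasoning
  N = suc (m + L)
  k = m + j

lemma4p5 : (n k m : ℕ) → 3 ≤ m → m ≤ k → k < n →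
           (+ count n m k) / 1 ≡ R m n k
lemma4p5 (suc n) k m 3≤m m≤k (s≤s k≤n) =
  subst₂ (λ n′ k′ → (+ count (suc n′) m k′) / 1 ≡ R m (suc n′) k′)
         (m+[n∸m]≡n (≤-trans m≤k k≤n)) (m+[n∸m]≡n m≤k)
         (count-formula m (n ∸ m) (k ∸ m) (≤-trans (s≤s z≤n) 3≤m) (∸-monoˡ-≤ m k≤n))
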